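{- Let $\alpha,\beta\in\mathbb{C}$ with $\beta\neq 0$ and $\alpha^2\neq 4\beta$, let $s$ be a fixed complex number with $s^2=\alpha^2-4\beta$, and let $n\geq 0$ be an integer. Then $$M_n^{(\alpha,\beta)}=\sum_{k=0}^{n+1}\Big(\frac{\alpha+s}{2}\Big)^{n-2k}\frac{\beta^k}{n+1}\binom{n+1}{k}\binom{n+1}{k+1} =\frac{s^{\,n+2}}{\beta}\sum_{k=0}^{n+1}\Big(\frac{\alpha}{s}-1\Big)^{k+1}\frac{C_k}{2^{k+1}}\binom{n+1+k}{2k}.$$
   Context: $C_k=\frac{1}{k+1}\binom{2k}{k}$ is the $k$-th Catalan number. A Motzkin path of order $m\geq 0$ is a lattice path from $(0,0)$ to $(m,m)$ with steps $\mathbf{D}=(1,1)$, $\mathbf{N}_2=(0,2)$, $\mathbf{E}_2=(2,0)$ never going below $y=x$ (empty path for $m=0$); $M_m^{(\alpha,\beta)}=\sum_P \alpha^{\#\mathbf{D}(P)}\beta^{\#\mathbf{E}_2(P)}$ over all Motzkin paths of order $m$, equivalently $M_m^{(\alpha,\beta)}=\sum_{j=0}^{\lfloor m/2\rfloor}\binom{m}{2j}C_j\alpha^{m-2j}\beta^j$. Note $\alpha+s\neq0$ under the hypotheses, since $(\alpha+s)(\alpha-s)=4\beta\neq0$. -}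

module Defs where

open import Level using (Level; _⊔_) renaming (suc to lsuc)
open import Data.Nat as ℕ using (ℕ; zero; suc)
open import Data.Nat.Combinatorics using (_C_)
open import Data.Integer as ℤ using (ℤ; +_; -[1+_])
open import Relation.Nullary using (¬_)
open import Algebra.Bundles using (CommutativeRing)

module _ {c ℓ : Level} (R : CommutativeRing c ℓ) where
  open CommutativeRing R
  ι : ℕ → Carrier
  ι zero    = 0#
  ι (suc n) = 1# + ι n

-- A field of characteristic zero (ℂ is the motivating instance).
-- The inverse is a total function, specified only on nonzero elements.
record CharZeroField (c ℓ : Level) : Set (lsuc (c ⊔ ℓ)) where
  field
    cring : CommutativeRing c ℓ
  open CommutativeRing cring public
  field
    _⁻¹        : Carrier → Carrier
    ⁻¹-inverse : ∀ x → ¬ (x ≈ 0#) → x * (x ⁻¹) ≈ 1#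
    char-zero  : ∀ n → ¬ (ι cring (suc n) ≈ 0#)

  infixl 8 _⁻¹

  ⟦_⟧ : ℕ → Carrier
  ⟦ n ⟧ = ι cring n

  _÷_ : Carrier → Carrier → Carrier
  x ÷ y = x * (y ⁻¹)

  _^ℕ_ : Carrier → ℕ → Carrier
  x ^ℕ zero  = 1#
  x ^ℕ suc n = x * (x ^ℕ n)

  _^ℤ_ : Carrier → ℤ → Carrier
  x ^ℤ (+ n)    = x ^ℕ n
  x ^ℤ -[1+ n ] = (x ⁻¹) ^ℕ suc n

  sumTo : ℕ → (ℕ → Carrier) → Carrier
  sumTo zero    f = f 0
  sumTo (suc n) f = sumTo n f + f (suc n)

-- Catalan number C_k = binom(2k,k)/(k+1) (exact division in ℕ)
catalan : ℕ → ℕ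
catalan k = ((2 ℕ.* k) C k) ℕ./ suc k

module _ {c ℓ : Level} (F : CharZeroField c ℓ) where
  open CharZeroField F

  motzkin : ℕ → Carrier → Carrier → Carrier
  motzkin m α β =
    sumTo (m ℕ./ 2) (λ j → ⟦ (m C (2 ℕ.* j)) ℕ.* catalan j ⟧
                             * (α ^ℕ (m ℕ.∸ 2 ℕ.* j)) * (β ^ℕ j))

-- Put x, y = (α ± s)/2, so that α = x + y, β = xy and s = x - y.  Coefficient
-- arrays of the powers of z + α + βz⁻¹ = (z + x)(z + y)/z are determined by a
-- three-term recurrence, so the expansions of these powers as trinomials in α, β
-- and as products in x, y agree.  By the reflection principle, the coefficient of
-- z⁰ minus β times that of z² is the Motzkin number in the trinomial expansion and,
-- through the 2×2 minors of Pascal's triangle, the Narayana sum in the product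
-- expansion.  Expanding (z + y + s)ⁿ⁺¹(z + y)ⁿ in powers of s instead, and using
-- the symmetry z ↦ β/z, splits its coefficient of zⁿ into the Catalan sum plus β
-- times its coefficient of zⁿ⁺², which yields the second identity.

module Submission where

open import Defs
open import Level using (Level)
open import Data.Nat as ℕ using (ℕ; suc)
open import Data.Nat.Combinatorics using (_C_)
open import Data.Integer as ℤ using (+_)
open import Data.Product using (_×_; _,_)
open import Relation.Nullary using (¬_)

module BinomialIdentities where

  open import Data.Nat using (zero; _+_; _*_; _∸_; _≤_; _<_; z≤n; s≤s)
  open import Data.Nat.Properties
  open import Data.Nat.Combinatorics using (nCk+nC[k+1]≡[n+1]C[k+1])
  open import Data.Nat.DivMod using (m*n/n≡m; m≡m%n+[m/n]*n; m%n<n)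
  open import Data.Nat.Tactic.RingSolver using (solve-∀)
  open import Data.Sum using (inj₁; inj₂)
  open import Relation.Binary.PropositionalEquality
  open ≡-Reasoning

  -- Pascal's rule as the definition, so that it holds definitionally.
  binom : ℕ → ℕ → ℕ
  binom n       zero    = 1
  binom zero    (suc k) = 0
  binom (suc n) (suc k) = binom n k + binom n (suc k)

  binom≡C : ∀ n k → binom n k ≡ n C k
  binom≡C n       zero    = refl
  binom≡C zero    (suc k) = refl
  binom≡C (suc n) (suc k) =
    trans (cong₂ _+_ (binom≡C n k) (binom≡C n (suc k))) (nCk+nC[k+1]≡[n+1]C[k+1] n k)

  binom≡0 : ∀ n k → n < k → binom n k ≡ 0
  binom≡0 zero    (suc k) _         = refl
  binom≡0 (suc n) (suc k) (s≤s n<k) = cong₂ _+_ (binom≡0 n k n<k) (binom≡0 n (suc k) (m<n⇒m<1+n n<k))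

  binom[n,n]≡1 : ∀ n → binom n n ≡ 1
  binom[n,n]≡1 zero    = refl
  binom[n,n]≡1 (suc n) = cong₂ _+_ (binom[n,n]≡1 n) (binom≡0 n (suc n) ≤-refl)

  binom[n,1]≡n : ∀ n → binom n 1 ≡ n
  binom[n,1]≡n zero    = refl
  binom[n,1]≡n (suc n) = cong suc (binom[n,1]≡n n)

  binom-sym : ∀ p q → binom (p + q) p ≡ binom (p + q) q
  binom-sym zero    q       = sym (binom[n,n]≡1 q)
  binom-sym (suc p) zero    = trans (cong (λ m → binom m (suc p)) (+-identityʳ (suc p))) (binom[n,n]≡1 (suc p))
  binom-sym (suc p) (suc q) =
    trans (cong₂ _+_ (binom-sym p (suc q)) shifted) (+-comm (binom (p + suc q) (suc q)) _)
    where
    shifted : binom (p + suc q) (suc p) ≡ binom (p + suc q) q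
    shifted = begin
      binom (p + suc q) (suc p) ≡⟨ cong (λ m → binom m (suc p)) (+-suc p q) ⟩
      binom (suc p + q) (suc p) ≡⟨ binom-sym (suc p) q ⟩
      binom (suc p + q) q       ≡⟨ cong (λ m → binom m q) (+-suc p q) ⟨
      binom (p + suc q) q       ∎

  binom-absorption : ∀ n k → suc k * binom (suc n) (suc k) ≡ suc n * binom n k
  binom-absorption zero    zero    = refl
  binom-absorption zero    (suc k) = trans (cong (suc (suc k) *_) (binom≡0 1 (suc (suc k)) (s≤s (s≤s z≤n)))) (*-zeroʳ (suc (suc k)))
  binom-absorption (suc n) zero    = trans (+-identityʳ _) (trans (binom[n,1]≡n (suc (suc n))) (sym (*-identityʳ (suc (suc n)))))
  binom-absorption (suc n) (suc k) = begin
    suc (suc k) * (binom (suc n) (suc k) + binom (suc n) (suc (suc k)))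
      ≡⟨ *-distribˡ-+ (suc (suc k)) (binom (suc n) (suc k)) _ ⟩
    suc (suc k) * binom (suc n) (suc k) + suc (suc k) * binom (suc n) (suc (suc k))
      ≡⟨ cong₂ (λ a b → binom (suc n) (suc k) + a + b) (binom-absorption n k) (binom-absorption n (suc k)) ⟩
    binom (suc n) (suc k) + suc n * binom n k + suc n * binom n (suc k)
      ≡⟨ regroup (binom (suc n) (suc k)) (suc n) (binom n k) (binom n (suc k)) ⟩
    binom (suc n) (suc k) + suc n * (binom n k + binom n (suc k)) ∎
    where
    regroup : ∀ a b c d → a + b * c + b * d ≡ a + b * (c + d)
    regroup = solve-∀

  binom-absorption′ : ∀ k d → suc d * binom (suc (k + d)) k ≡ suc (k + d) * binom (k + d) k
  binom-absorption′ k d = begin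
    suc d * binom (suc (k + d)) k     ≡⟨ cong (λ m → suc d * binom m k) (+-suc k d) ⟨
    suc d * binom (k + suc d) k       ≡⟨ cong (suc d *_) (binom-sym k (suc d)) ⟩
    suc d * binom (k + suc d) (suc d) ≡⟨ cong (λ m → suc d * binom m (suc d)) (+-suc k d) ⟩
    suc d * binom (suc (k + d)) (suc d) ≡⟨ binom-absorption (k + d) d ⟩
    suc (k + d) * binom (k + d) d     ≡⟨ cong (suc (k + d) *_) (binom-sym k d) ⟨
    suc (k + d) * binom (k + d) k     ∎

  binom-consecutive : ∀ k d → suc k * binom (k + d) (suc k) ≡ d * binom (k + d) k
  binom-consecutive k zero =
    trans (cong (λ m → suc k * binom m (suc k)) (+-identityʳ k)) (trans (cong (suc k *_) (binom≡0 k (suc k) ≤-refl)) (*-zeroʳ (suc k)))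
  binom-consecutive k (suc d) = begin
    suc k * binom (k + suc d) (suc k)   ≡⟨ cong (λ m → suc k * binom m (suc k)) (+-suc k d) ⟩
    suc k * binom (suc (k + d)) (suc k) ≡⟨ binom-absorption (k + d) k ⟩
    suc (k + d) * binom (k + d) k       ≡⟨ binom-absorption′ k d ⟨
    suc d * binom (suc (k + d)) k       ≡⟨ cong (λ m → suc d * binom m k) (+-suc k d) ⟨
    suc d * binom (k + suc d) k         ∎

  binom-central-ratio : ∀ j → suc j * binom (2 * suc j) (suc j) ≡ suc (suc j) * binom (2 * suc j) j
  binom-central-ratio j =
    subst (λ m → suc j * binom m (suc j) ≡ suc (suc j) * binom m j) (row j) (binom-consecutive j (suc (suc j)))
    where
    row : ∀ j → j + suc (suc j) ≡ 2 * suc j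
    row = solve-∀

  catalan*suc : ∀ k → catalan k * suc k ≡ binom (2 * k) k
  catalan*suc zero    = refl
  catalan*suc (suc j) = begin
    catalan (suc j) * suc (suc j)
      ≡⟨ cong (λ a → a ℕ./ suc (suc j) * suc (suc j)) (trans (sym (binom≡C (2 * suc j) (suc j))) (sym quotient)) ⟩
    (A ∸ B) * suc (suc j) ℕ./ suc (suc j) * suc (suc j) ≡⟨ cong (_* suc (suc j)) (m*n/n≡m (A ∸ B) (suc (suc j))) ⟩
    (A ∸ B) * suc (suc j)                                ≡⟨ quotient ⟩
    A                                                    ∎
    where
    A B : ℕ
    A = binom (2 * suc j) (suc j)
    B = binom (2 * suc j) j
    quotient : (A ∸ B) * suc (suc j) ≡ A
    quotient = begin
      (A ∸ B) * suc (suc j)                 ≡⟨ *-distribʳ-∸ (suc (suc j)) A B ⟩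
      A * suc (suc j) ∸ B * suc (suc j)     ≡⟨ cong₂ _∸_ (*-comm A (suc (suc j))) (*-comm B (suc (suc j))) ⟩
      A + suc j * A ∸ suc (suc j) * B       ≡⟨ cong (λ t → A + t ∸ suc (suc j) * B) (binom-central-ratio j) ⟩
      A + suc (suc j) * B ∸ suc (suc j) * B ≡⟨ m+n∸n≡m A (suc (suc j) * B) ⟩
      A                                     ∎

  catalan-ballot : ∀ j → catalan (suc j) + binom (2 * suc j) j ≡ binom (2 * suc j) (suc j)
  catalan-ballot j = *-cancelʳ-≡ _ _ (suc (suc j)) (begin
    (catalan (suc j) + B) * suc (suc j)             ≡⟨ *-distribʳ-+ (suc (suc j)) (catalan (suc j)) B ⟩
    catalan (suc j) * suc (suc j) + B * suc (suc j) ≡⟨ cong₂ _+_ (catalan*suc (suc j)) (*-comm B (suc (suc j))) ⟩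
    A + suc (suc j) * B                             ≡⟨ cong (λ t → A + t) (binom-central-ratio j) ⟨
    A + suc j * A                                   ≡⟨ *-comm (suc (suc j)) A ⟩
    A * suc (suc j)                                 ∎)
    where
    A B : ℕ
    A = binom (2 * suc j) (suc j)
    B = binom (2 * suc j) j

  -- The 2×2 minors of Pascal's triangle are Narayana numbers.
  NarayanaMinor : ℕ → ℕ → Set
  NarayanaMinor n k =
    binom (suc n) (suc k) * binom (suc n) (suc (suc k)) + suc n * (binom n k * binom n (suc (suc k)))
      ≡ suc n * (binom n (suc k) * binom n (suc k))

  narayana-minor-interior : ∀ k d → NarayanaMinor (suc k + d) k
  narayana-minor-interior k d = *-cancelʳ-≡ _ _ (suc k * suc (suc k)) (begin
    (X * Y + suc n * (v * w)) * (suc k * suc (suc k))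
      ≡⟨ spread X Y v w (suc k) (suc (suc k)) (suc n) ⟩
    (suc k * X) * (suc (suc k) * Y) + suc n * v * (suc (suc k) * w) * suc k
      ≡⟨ cong₂ (λ a b → a * b + suc n * v * (suc (suc k) * w) * suc k) (binom-absorption n k) (binom-absorption n (suc k)) ⟩
    suc n * v * (suc n * u) + suc n * v * (suc (suc k) * w) * suc k
      ≡⟨ cong (λ t → suc n * v * (suc n * u) + suc n * v * t * suc k) (binom-consecutive (suc k) d) ⟩
    suc n * v * (suc n * u) + suc n * v * (d * u) * suc k
      ≡⟨ collect k d u v ⟩
    suc n * u * suc (suc k) * (suc d * v)
      ≡⟨ cong (suc n * u * suc (suc k) *_) lower ⟨
    suc n * u * suc (suc k) * (suc k * u)
      ≡⟨ spread′ u (suc k) (suc (suc k)) (suc n) ⟩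
    suc n * (u * u) * (suc k * suc (suc k)) ∎)
    where
    n u v w X Y : ℕ
    n = suc k + d
    u = binom n (suc k)
    v = binom n k
    w = binom n (suc (suc k))
    X = binom (suc n) (suc k)
    Y = binom (suc n) (suc (suc k))
    lower : suc k * u ≡ suc d * v
    lower = subst (λ m → suc k * binom m (suc k) ≡ suc d * binom m k) (+-suc k d) (binom-consecutive k (suc d))
    spread : ∀ X Y v w a b c → (X * Y + c * (v * w)) * (a * b) ≡ (a * X) * (b * Y) + c * v * (b * w) * a
    spread = solve-∀
    spread′ : ∀ u a b c → c * u * b * (a * u) ≡ c * (u * u) * (a * b)
    spread′ = solve-∀
    -- (k + d + 2) + d (k + 1) = (k + 2) (d + 1)
    collect : ∀ k d u v → suc (suc k + d) * v * (suc (suc k + d) * u) + suc (suc k + d) * v * (d * u) * suc k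
                          ≡ suc (suc k + d) * u * suc (suc k) * (suc d * v)
    collect = solve-∀

  narayana-minor : ∀ n k → NarayanaMinor n k
  narayana-minor n k with ≤-<-connex n k
  ... | inj₁ n≤k = begin
    binom (suc n) (suc k) * binom (suc n) (suc (suc k)) + suc n * (binom n k * binom n (suc (suc k)))
      ≡⟨ cong₂ (λ a b → binom (suc n) (suc k) * a + suc n * (binom n k * b))
               (binom≡0 (suc n) (suc (suc k)) (s≤s (s≤s n≤k))) (binom≡0 n (suc (suc k)) (s≤s (m≤n⇒m≤1+n n≤k))) ⟩
    binom (suc n) (suc k) * 0 + suc n * (binom n k * 0) ≡⟨ zeros (binom (suc n) (suc k)) (binom n k) (suc n) ⟩
    suc n * (0 * 0)                                     ≡⟨ cong (λ a → suc n * (a * a)) (binom≡0 n (suc k) (s≤s n≤k)) ⟨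
    suc n * (binom n (suc k) * binom n (suc k))         ∎
    where
    zeros : ∀ a b c → a * 0 + c * (b * 0) ≡ c * (0 * 0)
    zeros = solve-∀
  ... | inj₂ k<n =
    subst (λ m → NarayanaMinor m k) (trans (+-comm (suc k) (n ∸ suc k)) (m∸n+n≡m k<n)) (narayana-minor-interior k (n ∸ suc k))

  binom-subset : ∀ a b c → binom (a + b + c) (a + b) * binom (a + b) a ≡ binom (a + b + c) a * binom (b + c) b
  binom-subset a b zero = begin
    binom (a + b + 0) (a + b) * binom (a + b) a ≡⟨ cong (λ m → binom m (a + b) * binom (a + b) a) (+-identityʳ (a + b)) ⟩
    binom (a + b) (a + b) * binom (a + b) a     ≡⟨ cong (_* binom (a + b) a) (binom[n,n]≡1 (a + b)) ⟩
    1 * binom (a + b) a                         ≡⟨ *-identityˡ _ ⟩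
    binom (a + b) a                             ≡⟨ cong (λ m → binom m a) (+-identityʳ (a + b)) ⟨
    binom (a + b + 0) a                         ≡⟨ *-identityʳ _ ⟨
    binom (a + b + 0) a * 1                     ≡⟨ cong (binom (a + b + 0) a *_) (trans (cong (λ m → binom m b) (+-identityʳ b)) (binom[n,n]≡1 b)) ⟨
    binom (a + b + 0) a * binom (b + 0) b       ∎
  binom-subset a b (suc c) =
    subst₂ (λ m l → binom m (a + b) * binom (a + b) a ≡ binom m a * binom l b) (sym (+-suc (a + b) c)) (sym (+-suc b c))
      (*-cancelʳ-≡ _ _ (suc c * suc (b + c)) (begin
        binom (suc m) (a + b) * binom (a + b) a * (suc c * suc (b + c))
          ≡⟨ swap₁ (binom (suc m) (a + b)) (binom (a + b) a) (suc c) (suc (b + c)) ⟩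
        suc c * binom (suc m) (a + b) * binom (a + b) a * suc (b + c)
          ≡⟨ cong (λ t → t * binom (a + b) a * suc (b + c)) (binom-absorption′ (a + b) c) ⟩
        suc m * binom m (a + b) * binom (a + b) a * suc (b + c)
          ≡⟨ swap₂ (binom m (a + b)) (binom (a + b) a) (suc m) (suc (b + c)) ⟩
        binom m (a + b) * binom (a + b) a * suc m * suc (b + c)
          ≡⟨ cong (λ t → t * suc m * suc (b + c)) (binom-subset a b c) ⟩
        binom m a * binom (b + c) b * suc m * suc (b + c)
          ≡⟨ swap₃ (binom m a) (binom (b + c) b) (suc m) (suc (b + c)) ⟩
        (suc m * binom m a) * (suc (b + c) * binom (b + c) b)
          ≡⟨ cong₂ _*_ outer (binom-absorption′ b c) ⟨
        (suc (b + c) * binom (suc m) a) * (suc c * binom (suc (b + c)) b)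
          ≡⟨ swap₄ (binom (suc m) a) (binom (suc (b + c)) b) (suc c) (suc (b + c)) ⟩
        binom (suc m) a * binom (suc (b + c)) b * (suc c * suc (b + c)) ∎))
    where
    m : ℕ
    m = a + b + c
    outer : suc (b + c) * binom (suc m) a ≡ suc m * binom m a
    outer = subst (λ l → suc (b + c) * binom (suc l) a ≡ suc l * binom l a) (sym (+-assoc a b c)) (binom-absorption′ a (b + c))
    swap₁ : ∀ x y p q → x * y * (p * q) ≡ p * x * y * q
    swap₁ = solve-∀
    swap₂ : ∀ x y p q → p * x * y * q ≡ x * y * p * q
    swap₂ = solve-∀
    swap₃ : ∀ x y p q → x * y * p * q ≡ (p * x) * (q * y)
    swap₃ = solve-∀
    swap₄ : ∀ x y p q → (q * x) * (p * y) ≡ x * y * (p * q)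
    swap₄ = solve-∀

  binom-two-below : ∀ n i → binom (n + suc i) (suc (suc n)) * (suc n * suc (suc n)) ≡ binom (n + suc i) (suc i) * (suc i * i)
  binom-two-below n i = begin
    binom N (suc (suc n)) * (suc n * suc (suc n)) ≡⟨ rotate (binom N (suc (suc n))) (suc n) (suc (suc n)) ⟩
    suc n * (suc (suc n) * binom N (suc (suc n))) ≡⟨ cong (suc n *_) upper ⟩
    suc n * (i * binom N (suc n))                 ≡⟨ exchange (suc n) i (binom N (suc n)) ⟩
    i * (suc n * binom N (suc n))                 ≡⟨ cong (i *_) (binom-consecutive n (suc i)) ⟩
    i * (suc i * binom N n)                       ≡⟨ cong (λ t → i * (suc i * t)) (binom-sym n (suc i)) ⟩
    i * (suc i * binom N (suc i))                 ≡⟨ rotate′ i (suc i) (binom N (suc i)) ⟩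
    binom N (suc i) * (suc i * i)                 ∎
    where
    N : ℕ
    N = n + suc i
    upper : suc (suc n) * binom N (suc (suc n)) ≡ i * binom N (suc n)
    upper = subst (λ m → suc (suc n) * binom m (suc (suc n)) ≡ i * binom m (suc n)) (sym (+-suc n i)) (binom-consecutive (suc n) i)
    rotate : ∀ x p q → x * (p * q) ≡ p * (q * x)
    rotate = solve-∀
    exchange : ∀ x y z → x * (y * z) ≡ y * (x * z)
    exchange = solve-∀
    rotate′ : ∀ x y z → x * (y * z) ≡ z * (y * x)
    rotate′ = solve-∀

  catalan*binom : ∀ j e → catalan j * binom (j + j + e) (2 * j) * suc j ≡ binom (j + j + e) j * binom (j + e) j
  catalan*binom j e = begin
    catalan j * binom (j + j + e) (2 * j) * suc j ≡⟨ swap (catalan j) (binom (j + j + e) (2 * j)) (suc j) ⟩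
    binom (j + j + e) (2 * j) * (catalan j * suc j) ≡⟨ cong (binom (j + j + e) (2 * j) *_) (catalan*suc j) ⟩
    binom (j + j + e) (2 * j) * binom (2 * j) j    ≡⟨ cong (λ m → binom (j + j + e) m * binom m j) (double j) ⟩
    binom (j + j + e) (j + j) * binom (j + j) j    ≡⟨ binom-subset j j e ⟩
    binom (j + j + e) j * binom (j + e) j          ∎
    where
    swap : ∀ x y z → x * y * z ≡ y * (x * z)
    swap = solve-∀
    double : ∀ j → 2 * j ≡ j + j
    double = solve-∀

  CatalanDecomposition : ℕ → ℕ → Set
  CatalanDecomposition n j =
    binom (suc n) j * binom (n + j) n
      ≡ catalan j * binom (suc n + j) (2 * j) + binom (suc n) j * binom (n + j) (suc (suc n))
        + binom (suc n) (suc j) * binom (n + suc j) (suc (suc n))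

  catalan-decomposition-interior : ∀ i e → CatalanDecomposition (i + e) (suc i)
  catalan-decomposition-interior i e = *-cancelʳ-≡ _ _ K (begin
    P₀ * binom (n + j) n * K                             ≡⟨ cong (λ t → P₀ * t * K) (binom-sym n j) ⟩
    P₀ * Q * K                                           ≡⟨ expand i e P₀ Q ⟩
    suc (n + j) * Q * P₀ * suc (suc n) + P₀ * (Q * (j * i)) * suc j + e * P₀ * (suc (n + j) * Q * j)
      ≡⟨ cong₂ (λ a b → a * P₀ * suc (suc n) + P₀ * b * suc j + e * P₀ * (suc (n + j) * Q * j)) column (binom-two-below n i) ⟨
    suc n * binom (suc n + j) j * P₀ * suc (suc n) + P₀ * (B₂ * (suc n * suc (suc n))) * suc j + e * P₀ * (suc (n + j) * Q * j)
      ≡⟨ cong₂ (λ a b → suc n * binom (suc n + j) j * P₀ * suc (suc n) + P₀ * (B₂ * (suc n * suc (suc n))) * suc j + a * b) row last ⟨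
    suc n * binom (suc n + j) j * P₀ * suc (suc n) + P₀ * (B₂ * (suc n * suc (suc n))) * suc j + P₁ * suc j * (B₃ * (suc n * suc (suc n)))
      ≡⟨ cong (λ a → a + P₀ * (B₂ * (suc n * suc (suc n))) * suc j + P₁ * suc j * (B₃ * (suc n * suc (suc n))))
              (trans (rotate (suc n) (binom (suc n + j) j) P₀ (suc (suc n))) (cong (_* (suc n * suc (suc n))) (sym catalan-part))) ⟩
    T * suc j * (suc n * suc (suc n)) + P₀ * (B₂ * (suc n * suc (suc n))) * suc j + P₁ * suc j * (B₃ * (suc n * suc (suc n)))
      ≡⟨ collect T P₀ B₂ P₁ B₃ (suc j) (suc n * suc (suc n)) ⟩
    (T + P₀ * B₂ + P₁ * B₃) * K ∎)
    where
    n j K P₀ P₁ Q T B₂ B₃ : ℕ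
    n = i + e
    j = suc i
    K = suc j * (suc n * suc (suc n))
    P₀ = binom (suc n) j
    P₁ = binom (suc n) (suc j)
    Q = binom (n + j) j
    T = catalan j * binom (suc n + j) (2 * j)
    B₂ = binom (n + j) (suc (suc n))
    B₃ = binom (n + suc j) (suc (suc n))
    catalan-part : T * suc j ≡ binom (suc n + j) j * P₀
    catalan-part = subst (λ m → catalan j * binom m (2 * j) * suc j ≡ binom m j * P₀) (sym (sizes i e)) (catalan*binom j e)
      where
      sizes : ∀ i e → suc (i + e) + suc i ≡ suc i + suc i + e
      sizes = solve-∀
    column : suc n * binom (suc n + j) j ≡ suc (n + j) * Q
    column = subst (λ m → suc n * binom (suc m) j ≡ suc m * binom m j) (+-comm j n) (binom-absorption′ j n)
    row : P₁ * suc j ≡ e * P₀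
    row = trans (*-comm P₁ (suc j)) (binom-consecutive j e)
    last : B₃ * (suc n * suc (suc n)) ≡ suc (n + j) * Q * j
    last = begin
      B₃ * (suc n * suc (suc n))             ≡⟨ binom-two-below n j ⟩
      binom (n + suc j) (suc j) * (suc j * j) ≡⟨ regroup (binom (n + suc j) (suc j)) (suc j) j ⟩
      suc j * binom (n + suc j) (suc j) * j   ≡⟨ cong (λ m → suc j * binom m (suc j) * j) (+-suc n j) ⟩
      suc j * binom (suc (n + j)) (suc j) * j ≡⟨ cong (_* j) (binom-absorption (n + j) j) ⟩
      suc (n + j) * Q * j                     ∎
      where
      regroup : ∀ x p q → x * (p * q) ≡ p * x * q
      regroup = solve-∀
    expand : ∀ i e P Q →
      P * Q * (suc (suc i) * (suc (i + e) * suc (suc (i + e))))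
        ≡ suc (i + e + suc i) * Q * P * suc (suc (i + e)) + P * (Q * (suc i * i)) * suc (suc i)
          + e * P * (suc (i + e + suc i) * Q * suc i)
    expand = solve-∀
    rotate : ∀ a b c d → a * b * c * d ≡ b * c * (a * d)
    rotate = solve-∀
    collect : ∀ t p b q c k₁ k₂ → t * k₁ * k₂ + p * (b * k₂) * k₁ + q * k₁ * (c * k₂) ≡ (t + p * b + q * c) * (k₁ * k₂)
    collect = solve-∀

  catalan-decomposition : ∀ n j → CatalanDecomposition n j
  catalan-decomposition n zero = begin
    1 * binom (n + 0) n ≡⟨ trans (*-identityˡ _) (cong (λ m → binom m n) (+-identityʳ n)) ⟩
    binom n n           ≡⟨ binom[n,n]≡1 n ⟩
    1                   ≡⟨ cong suc (*-zeroʳ (binom (suc n) 1)) ⟨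
    1 * 1 + 1 * 0 + binom (suc n) 1 * 0
      ≡⟨ cong₂ (λ a b → 1 * 1 + 1 * a + binom (suc n) 1 * b)
               (binom≡0 (n + 0) (suc (suc n)) (subst (_< suc (suc n)) (sym (+-identityʳ n)) (m<n⇒m<1+n (n<1+n n))))
               (binom≡0 (n + 1) (suc (suc n)) (subst (_< suc (suc n)) (+-comm 1 n) ≤-refl)) ⟨
    1 * 1 + 1 * binom (n + 0) (suc (suc n)) + binom (suc n) 1 * binom (n + 1) (suc (suc n)) ∎
  catalan-decomposition n (suc i) with ≤-<-connex i n
  ... | inj₁ i≤n = subst (λ m → CatalanDecomposition m (suc i)) (m+[n∸m]≡n i≤n) (catalan-decomposition-interior i (n ∸ i))
  ... | inj₂ n<i = begin
    binom (suc n) (suc i) * binom (n + suc i) n ≡⟨ cong (_* binom (n + suc i) n) P₀≡0 ⟩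
    0                                           ≡⟨ zeros (catalan (suc i)) (binom (n + suc i) (suc (suc n))) (binom (n + suc (suc i)) (suc (suc n))) ⟩
    catalan (suc i) * 0 + 0 * binom (n + suc i) (suc (suc n)) + 0 * binom (n + suc (suc i)) (suc (suc n))
      ≡⟨ cong₂ (λ b c → catalan (suc i) * 0 + b * binom (n + suc i) (suc (suc n)) + c * binom (n + suc (suc i)) (suc (suc n))) P₀≡0 P₁≡0 ⟨
    catalan (suc i) * 0 + binom (suc n) (suc i) * binom (n + suc i) (suc (suc n))
      + binom (suc n) (suc (suc i)) * binom (n + suc (suc i)) (suc (suc n))
      ≡⟨ cong (λ a → catalan (suc i) * a + binom (suc n) (suc i) * binom (n + suc i) (suc (suc n))
                       + binom (suc n) (suc (suc i)) * binom (n + suc (suc i)) (suc (suc n)))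
              (binom≡0 (suc n + suc i) (2 * suc i) too-short) ⟨
    catalan (suc i) * binom (suc n + suc i) (2 * suc i) + binom (suc n) (suc i) * binom (n + suc i) (suc (suc n))
      + binom (suc n) (suc (suc i)) * binom (n + suc (suc i)) (suc (suc n)) ∎
    where
    P₀≡0 : binom (suc n) (suc i) ≡ 0
    P₀≡0 = binom≡0 (suc n) (suc i) (s≤s n<i)
    P₁≡0 : binom (suc n) (suc (suc i)) ≡ 0
    P₁≡0 = binom≡0 (suc n) (suc (suc i)) (s≤s (m<n⇒m<1+n n<i))
    too-short : suc n + suc i < 2 * suc i
    too-short = subst₂ _<_ (sym (+-suc (suc n) i)) (double i) (s≤s (s≤s (+-monoˡ-< i n<i)))
      where
      double : ∀ i → suc (suc (i + i)) ≡ 2 * suc i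
      double = solve-∀
    zeros : ∀ a b c → 0 ≡ a * 0 + 0 * b + 0 * c
    zeros = solve-∀

  double : ℕ → ℕ
  double zero    = zero
  double (suc j) = suc (suc (double j))

  double≡2* : ∀ j → double j ≡ 2 * j
  double≡2* zero    = refl
  double≡2* (suc j) = trans (cong (λ m → suc (suc m)) (double≡2* j)) (shift j)
    where
    shift : ∀ j → suc (suc (2 * j)) ≡ 2 * suc j
    shift = solve-∀

  n≤double : ∀ n → n ≤ double n
  n≤double zero    = z≤n
  n≤double (suc n) = s≤s (m≤n⇒m≤1+n (n≤double n))

  binom-middle : ∀ j → binom (suc (double j)) (suc j) ≡ binom (suc (double j)) j
  binom-middle j = subst (λ m → binom m (suc j) ≡ binom m j) (sym (odd j)) (sym (binom-sym j (suc j)))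
    where
    odd : ∀ j → suc (double j) ≡ j + suc j
    odd zero    = refl
    odd (suc j) = cong suc (trans (cong suc (odd j)) (sym (+-suc j (suc j))))

  /2<⇒<2* : ∀ n j → n ℕ./ 2 < j → n < 2 * j
  /2<⇒<2* n j lt =
    ≤-trans (≤-reflexive (cong suc (m≡m%n+[m/n]*n n 2)))
      (≤-trans (+-monoˡ-≤ (n ℕ./ 2 * 2) (m%n<n n 2))
        (≤-trans (*-monoˡ-≤ 2 lt) (≤-reflexive (*-comm j 2))))

module CoefficientArrays {c ℓ : Level} (F : CharZeroField c ℓ) where

  open CharZeroField F
  open BinomialIdentities
  open import Level using (_⊔_)
  open import Data.Nat using (zero; _∸_; _≤_; _<_; z≤n; s≤s)
  import Data.Nat.Properties as ℕₚ
  open import Data.Sum using (inj₁; inj₂)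
  open import Data.Nat.DivMod using (m/n≤m)
  open import Relation.Binary.PropositionalEquality as ≡ using (_≡_)
  open import Data.Nat.Tactic.RingSolver using (solve-∀)
  open import Relation.Binary.Reasoning.Setoid setoid
  open import Algebra.Solver.Ring.NaturalCoefficients.Default commutativeSemiring using (solve; _:=_; _:+_; _:*_)
  open import Algebra.Properties.Monoid.Mult +-monoid using (×-homo-+) renaming (_×_ to _×₊_)
  open import Algebra.Properties.Semiring.Mult semiring using (×1-homo-*)
  open import Algebra.Properties.Semiring.Exp semiring using (_^_; ^-congˡ; ^-homo-*)
  open import Algebra.Properties.CommutativeSemiring.Exp commutativeSemiring using (^-distrib-*)
  open import Algebra.Properties.CommutativeSemigroup +-commutativeSemigroup using () renaming (interchange to +-interchange)
  open import Algebra.Properties.CommutativeSemigroup *-commutativeSemigroup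
    using (x∙yz≈y∙xz; xy∙z≈y∙xz; x∙yz≈xy∙z; xy∙z≈zx∙y; xy∙z≈xz∙y) renaming (interchange to *-interchange)
  open import Algebra.Properties.Group +-group using (x∙y⁻¹≈ε⇒x≈y) renaming (∙-cancelʳ to +-cancelʳ)
  open import Algebra.Properties.AbelianGroup +-abelianGroup using (⁻¹-anti-homo‿-)
  open import Algebra.Properties.Ring ring using (-‿distribʳ-*; -‿distribˡ-*)
  open import Data.Integer.Properties using ([+m]-[+n]≡m⊖n; [1+m]⊖[1+n]≡m⊖n; +-cancelˡ-⊖)

  ⟦⟧≡×1 : ∀ n → ⟦ n ⟧ ≡ n ×₊ 1#
  ⟦⟧≡×1 zero    = ≡.refl
  ⟦⟧≡×1 (suc n) = ≡.cong (λ t → 1# + t) (⟦⟧≡×1 n)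

  ⟦⟧-homo-+ : ∀ m n → ⟦ m ℕ.+ n ⟧ ≈ ⟦ m ⟧ + ⟦ n ⟧
  ⟦⟧-homo-+ m n rewrite ⟦⟧≡×1 (m ℕ.+ n) | ⟦⟧≡×1 m | ⟦⟧≡×1 n = ×-homo-+ 1# m n

  ⟦⟧-homo-* : ∀ m n → ⟦ m ℕ.* n ⟧ ≈ ⟦ m ⟧ * ⟦ n ⟧
  ⟦⟧-homo-* m n rewrite ⟦⟧≡×1 (m ℕ.* n) | ⟦⟧≡×1 m | ⟦⟧≡×1 n = ×1-homo-* m n

  ⟦1⟧≈1 : ⟦ 1 ⟧ ≈ 1#
  ⟦1⟧≈1 = +-identityʳ 1#

  ^ℕ≡^ : ∀ x n → x ^ℕ n ≡ x ^ n
  ^ℕ≡^ x zero    = ≡.refl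
  ^ℕ≡^ x (suc n) = ≡.cong (x *_) (^ℕ≡^ x n)

  ^ℕ-congˡ : ∀ {x y} n → x ≈ y → x ^ℕ n ≈ y ^ℕ n
  ^ℕ-congˡ {x} {y} n x≈y rewrite ^ℕ≡^ x n | ^ℕ≡^ y n = ^-congˡ n x≈y

  ^ℕ-homo-* : ∀ x m n → x ^ℕ (m ℕ.+ n) ≈ x ^ℕ m * x ^ℕ n
  ^ℕ-homo-* x m n rewrite ^ℕ≡^ x (m ℕ.+ n) | ^ℕ≡^ x m | ^ℕ≡^ x n = ^-homo-* x m n

  ^ℕ-distrib-* : ∀ x y n → (x * y) ^ℕ n ≈ x ^ℕ n * y ^ℕ n
  ^ℕ-distrib-* x y n rewrite ^ℕ≡^ (x * y) n | ^ℕ≡^ x n | ^ℕ≡^ y n = ^-distrib-* x y n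

  sumTo-cong : ∀ n {f g : ℕ → Carrier} → (∀ i → i ≤ n → f i ≈ g i) → sumTo n f ≈ sumTo n g
  sumTo-cong zero    f≈g = f≈g 0 z≤n
  sumTo-cong (suc n) f≈g = +-cong (sumTo-cong n (λ i i≤n → f≈g i (ℕₚ.m≤n⇒m≤1+n i≤n))) (f≈g (suc n) ℕₚ.≤-refl)

  sumTo≈0 : ∀ n {f : ℕ → Carrier} → (∀ i → i ≤ n → f i ≈ 0#) → sumTo n f ≈ 0#
  sumTo≈0 zero    f≈0 = f≈0 0 z≤n
  sumTo≈0 (suc n) f≈0 =
    trans (+-cong (sumTo≈0 n (λ i i≤n → f≈0 i (ℕₚ.m≤n⇒m≤1+n i≤n))) (f≈0 (suc n) ℕₚ.≤-refl)) (+-identityʳ 0#)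

  sumTo-+ : ∀ n (f g : ℕ → Carrier) → sumTo n (λ i → f i + g i) ≈ sumTo n f + sumTo n g
  sumTo-+ zero    f g = refl
  sumTo-+ (suc n) f g = trans (+-cong (sumTo-+ n f g) refl) (+-interchange _ _ _ _)

  *-distribˡ-sumTo : ∀ n a (f : ℕ → Carrier) → a * sumTo n f ≈ sumTo n (λ i → a * f i)
  *-distribˡ-sumTo zero    a f = refl
  *-distribˡ-sumTo (suc n) a f = trans (distribˡ a _ _) (+-cong (*-distribˡ-sumTo n a f) refl)

  sumTo-head : ∀ n (f : ℕ → Carrier) → sumTo (suc n) f ≈ f 0 + sumTo n (λ i → f (suc i))
  sumTo-head zero    f = refl
  sumTo-head (suc n) f = trans (+-cong (sumTo-head n f) refl) (+-assoc _ _ _)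

  sumTo-dropLast : ∀ n (f : ℕ → Carrier) → f (suc n) ≈ 0# → sumTo (suc n) f ≈ sumTo n f
  sumTo-dropLast n f last≈0 = trans (+-cong refl last≈0) (+-identityʳ _)

  sumTo-truncate : ∀ {m n} (f : ℕ → Carrier) → m ≤ n → (∀ i → m < i → f i ≈ 0#) → sumTo n f ≈ sumTo m f
  sumTo-truncate {m} f m≤n tail≈0 = go (ℕₚ.m+[n∸m]≡n m≤n)
    where
    go : ∀ {k n} → m ℕ.+ k ≡ n → sumTo n f ≈ sumTo m f
    go {zero}  ≡.refl = reflexive (≡.cong (λ l → sumTo l f) (ℕₚ.+-identityʳ m))
    go {suc k} ≡.refl = begin
      sumTo (m ℕ.+ suc k) f   ≡⟨ ≡.cong (λ l → sumTo l f) (ℕₚ.+-suc m k) ⟩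
      sumTo (suc (m ℕ.+ k)) f ≈⟨ sumTo-dropLast (m ℕ.+ k) f (tail≈0 _ (s≤s (ℕₚ.m≤m+n m k))) ⟩
      sumTo (m ℕ.+ k) f       ≈⟨ go {k} ≡.refl ⟩
      sumTo m f               ∎

  sumTo-shifted-+ : ∀ n (t p r : ℕ → Carrier) →
                    t 0 ≈ p 0 → (∀ j → j ≤ n → t (suc j) ≈ p (suc j) + r j) → sumTo (suc n) t ≈ sumTo (suc n) p + sumTo n r
  sumTo-shifted-+ n t p r head tail = begin
    sumTo (suc n) t                                      ≈⟨ sumTo-head n t ⟩
    t 0 + sumTo n (λ j → t (suc j))                      ≈⟨ +-cong head (sumTo-cong n tail) ⟩
    p 0 + sumTo n (λ j → p (suc j) + r j)                ≈⟨ +-cong refl (sumTo-+ n _ r) ⟩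
    p 0 + (sumTo n (λ j → p (suc j)) + sumTo n r)        ≈⟨ +-assoc _ _ _ ⟨
    p 0 + sumTo n (λ j → p (suc j)) + sumTo n r          ≈⟨ +-cong (sumTo-head n p) refl ⟨
    sumTo (suc n) p + sumTo n r                          ∎

  sumTo-shifted-+′ : ∀ n (t p r : ℕ → Carrier) → p (suc n) ≈ 0# →
                     t 0 ≈ p 0 → (∀ j → j ≤ n → t (suc j) ≈ p (suc j) + r j) → sumTo (suc n) t ≈ sumTo n p + sumTo n r
  sumTo-shifted-+′ n t p r last≈0 head tail =
    trans (sumTo-shifted-+ n t p r head tail) (+-cong (sumTo-dropLast n p last≈0) refl)

  sumTo-linear : ∀ n a b (f g : ℕ → Carrier) → sumTo n (λ i → a * f i + b * g i) ≈ a * sumTo n f + b * sumTo n g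
  sumTo-linear n a b f g =
    trans (sumTo-+ n _ _) (sym (+-cong (*-distribˡ-sumTo n a f) (*-distribˡ-sumTo n b g)))

  sumTo-linear₁ : ∀ n a (f g : ℕ → Carrier) → sumTo n (λ i → f i + a * g i) ≈ sumTo n f + a * sumTo n g
  sumTo-linear₁ n a f g = trans (sumTo-+ n _ _) (+-cong refl (sym (*-distribˡ-sumTo n a g)))

  -- Opaque, so that unification can read the coefficient k off a monomial.
  opaque
    monomial : ℕ → Carrier → ℕ → Carrier → ℕ → Carrier
    monomial k a p b q = ⟦ k ⟧ * a ^ℕ p * b ^ℕ q

  opaque
    unfolding monomial

    monomial≈0 : ∀ {k} a p b q → k ≡ 0 → monomial k a p b q ≈ 0#
    monomial≈0 a p b q ≡.refl = trans (*-cong (zeroˡ _) refl) (zeroˡ _)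

    monomial-homo-+ : ∀ k l a p b q → monomial (k ℕ.+ l) a p b q ≈ monomial k a p b q + monomial l a p b q
    monomial-homo-+ k l a p b q =
      trans (*-cong (*-cong (⟦⟧-homo-+ k l) refl) refl) (trans (*-cong (distribʳ _ _ _) refl) (distribʳ _ _ _))

    monomial≡ : ∀ k a p b q → monomial k a p b q ≡ ⟦ k ⟧ * a ^ℕ p * b ^ℕ q
    monomial≡ k a p b q = ≡.refl

    monomial-constant : ∀ k a b → monomial k a 0 b 0 ≈ ⟦ k ⟧
    monomial-constant k a b = trans (*-identityʳ _) (*-identityʳ _)

    monomial-sucʳ : ∀ k a p b q → monomial k a p b (suc q) ≈ b * monomial k a p b q
    monomial-sucʳ k a p b q = x∙yz≈y∙xz (⟦ k ⟧ * a ^ℕ p) b (b ^ℕ q)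

    -- Where n ∸ m truncates, the coefficient is zero, so no exponent is lost.
    monomial-∸-step : ∀ k a n m b q → (n ≤ m → k ≡ 0) → monomial k a (n ∸ m) b q ≈ a * monomial k a (n ∸ suc m) b q
    monomial-∸-step k a zero    m       b q k≡0 =
      trans (monomial≈0 a (0 ∸ m) b q (k≡0 z≤n)) (sym (trans (*-cong refl (monomial≈0 a (0 ∸ suc m) b q (k≡0 z≤n))) (zeroʳ a)))
    monomial-∸-step k a (suc n) zero    b q k≡0 = trans (*-cong (x∙yz≈y∙xz ⟦ k ⟧ a (a ^ℕ n)) refl) (*-assoc _ _ _)
    monomial-∸-step k a (suc n) (suc m) b q k≡0 = monomial-∸-step k a n m b q (λ n≤m → k≡0 (s≤s n≤m))

    monomial-∸-stepʳ : ∀ k a p b n m → (n ≤ m → k ≡ 0) → monomial k a p b (n ∸ m) ≈ b * monomial k a p b (n ∸ suc m)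
    monomial-∸-stepʳ k a p b zero    m       k≡0 =
      trans (monomial≈0 a p b (0 ∸ m) (k≡0 z≤n)) (sym (trans (*-cong refl (monomial≈0 a p b (0 ∸ suc m) (k≡0 z≤n))) (zeroʳ b)))
    monomial-∸-stepʳ k a p b (suc n) zero    k≡0 = x∙yz≈y∙xz _ b (b ^ℕ n)
    monomial-∸-stepʳ k a p b (suc n) (suc m) k≡0 = monomial-∸-stepʳ k a p b n m (λ n≤m → k≡0 (s≤s n≤m))

  δ₀ : ℕ → Carrier
  δ₀ zero    = 1#
  δ₀ (suc _) = 0#

  -- T n h is the coefficient of zʰ in (z + α + β z⁻¹)ⁿ; the boundary equation
  -- uses the symmetry [z⁻¹] = β [z¹] of that Laurent polynomial.
  record IsTrinomialArray (α β : Carrier) (T : ℕ → ℕ → Carrier) : Set (c ⊔ ℓ) where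
    field
      initial  : ∀ h → T 0 h ≈ δ₀ h
      boundary : ∀ n → T (suc n) 0 ≈ α * T n 0 + (β + β) * T n 1
      interior : ∀ n h → T (suc n) (suc h) ≈ T n h + α * T n (suc h) + β * T n (suc (suc h))

  trinomialArray-unique : ∀ {α β T T′} → IsTrinomialArray α β T → IsTrinomialArray α β T′ → ∀ n h → T n h ≈ T′ n h
  trinomialArray-unique A A′ zero h =
    trans (IsTrinomialArray.initial A h) (sym (IsTrinomialArray.initial A′ h))
  trinomialArray-unique {T = T} {T′} A A′ (suc n) zero =
    trans (IsTrinomialArray.boundary A n)
      (trans (+-cong (*-cong refl (agree 0)) (*-cong refl (agree 1))) (sym (IsTrinomialArray.boundary A′ n)))
    where
    agree : ∀ h → T n h ≈ T′ n h
    agree = trinomialArray-unique A A′ n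
  trinomialArray-unique {T = T} {T′} A A′ (suc n) (suc h) =
    trans (IsTrinomialArray.interior A n h)
      (trans (+-cong (+-cong (agree h) (*-cong refl (agree (suc h)))) (*-cong refl (agree (suc (suc h)))))
        (sym (IsTrinomialArray.interior A′ n h)))
    where
    agree : ∀ h → T n h ≈ T′ n h
    agree = trinomialArray-unique A A′ n

  -- Choose h + 2j of the n factors to contribute z or βz⁻¹, and j of those to contribute βz⁻¹.
  trinomialTerm : Carrier → Carrier → ℕ → ℕ → ℕ → Carrier
  trinomialTerm α β n h j = monomial (binom n (h ℕ.+ double j) ℕ.* binom (h ℕ.+ double j) j) α (n ∸ (h ℕ.+ double j)) β j

  trinomial : Carrier → Carrier → ℕ → ℕ → Carrier
  trinomial α β n h = sumTo n (trinomialTerm α β n h)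

  module _ (α β : Carrier) where

    private
      t : ℕ → ℕ → ℕ → Carrier
      t = trinomialTerm α β

    trinomialTerm-last : ∀ n h → t n h (suc n) ≈ 0#
    trinomialTerm-last n h =
      monomial≈0 α _ β (suc n) (≡.cong (ℕ._* binom (h ℕ.+ double (suc n)) (suc n)) (binom≡0 n _ n<m))
      where
      n<m : n < h ℕ.+ double (suc n)
      n<m = ℕₚ.≤-trans (s≤s (ℕₚ.m≤n⇒m≤1+n (n≤double n))) (ℕₚ.m≤n+m (double (suc n)) h)

    trinomialTerm-interior₀ : ∀ n h → t (suc n) (suc h) 0 ≈ t n h 0 + α * t n (suc h) 0
    trinomialTerm-interior₀ n h = begin
      monomial ((binom n m ℕ.+ binom n (suc m)) ℕ.* 1) α (n ∸ m) β 0
        ≡⟨ ≡.cong (λ k → monomial k α (n ∸ m) β 0) (ℕₚ.*-distribʳ-+ 1 (binom n m) (binom n (suc m))) ⟩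
      monomial (binom n m ℕ.* 1 ℕ.+ binom n (suc m) ℕ.* 1) α (n ∸ m) β 0
        ≈⟨ monomial-homo-+ (binom n m ℕ.* 1) _ α (n ∸ m) β 0 ⟩
      t n h 0 + monomial (binom n (suc m) ℕ.* 1) α (n ∸ m) β 0
        ≈⟨ +-cong refl (monomial-∸-step _ α n m β 0 (λ n≤m → ≡.cong (ℕ._* 1) (binom≡0 n (suc m) (s≤s n≤m)))) ⟩
      t n h 0 + α * t n (suc h) 0 ∎
      where
      m : ℕ
      m = h ℕ.+ 0

    trinomialTerm-interior : ∀ n h j → t (suc n) (suc h) (suc j) ≈ (t n h (suc j) + α * t n (suc h) (suc j)) + β * t n (suc (suc h)) j
    trinomialTerm-interior n h j = begin
      monomial ((binom n m ℕ.+ binom n (suc m)) ℕ.* binom (suc m) (suc j)) α (n ∸ m) β (suc j)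
        ≡⟨ ≡.cong (λ k → monomial k α (n ∸ m) β (suc j)) (split (binom n m) (binom n (suc m)) (binom m j) (binom m (suc j))) ⟩
      monomial (binom n m ℕ.* binom m (suc j) ℕ.+ binom n (suc m) ℕ.* binom (suc m) (suc j) ℕ.+ binom n m ℕ.* binom m j) α (n ∸ m) β (suc j)
        ≈⟨ trans (monomial-homo-+ _ _ α (n ∸ m) β (suc j)) (+-cong (monomial-homo-+ _ _ α (n ∸ m) β (suc j)) refl) ⟩
      t n h (suc j) + monomial (binom n (suc m) ℕ.* binom (suc m) (suc j)) α (n ∸ m) β (suc j)
                    + monomial (binom n m ℕ.* binom m j) α (n ∸ m) β (suc j)
        ≈⟨ +-cong (+-cong refl (monomial-∸-step _ α n m β (suc j) (λ n≤m → ≡.cong (ℕ._* _) (binom≡0 n (suc m) (s≤s n≤m)))))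
                  (monomial-sucʳ _ α (n ∸ m) β j) ⟩
      t n h (suc j) + α * t n (suc h) (suc j) + β * monomial (binom n m ℕ.* binom m j) α (n ∸ m) β j
        ≡⟨ ≡.cong (λ m′ → t n h (suc j) + α * t n (suc h) (suc j) + β * monomial (binom n m′ ℕ.* binom m′ j) α (n ∸ m′) β j) two-more ⟩
      t n h (suc j) + α * t n (suc h) (suc j) + β * t n (suc (suc h)) j ∎
      where
      m : ℕ
      m = h ℕ.+ double (suc j)
      two-more : m ≡ suc (suc h) ℕ.+ double j
      two-more = ≡.trans (ℕₚ.+-suc h (suc (double j))) (≡.cong suc (ℕₚ.+-suc h (double j)))
      split : ∀ a b u v → (a ℕ.+ b) ℕ.* (u ℕ.+ v) ≡ a ℕ.* v ℕ.+ b ℕ.* (u ℕ.+ v) ℕ.+ a ℕ.* u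
      split = solve-∀

    trinomialTerm-boundary₀ : ∀ n → t (suc n) 0 0 ≈ α * t n 0 0
    trinomialTerm-boundary₀ n = monomial-∸-step _ α (suc n) 0 β 0 (λ ())

    trinomialTerm-boundary : ∀ n j → t (suc n) 0 (suc j) ≈ α * t n 0 (suc j) + (β + β) * t n 1 j
    trinomialTerm-boundary n j = begin
      monomial ((binom n (suc D) ℕ.+ binom n (suc (suc D))) ℕ.* binom (suc (suc D)) (suc j)) α (n ∸ suc D) β (suc j)
        ≡⟨ ≡.cong (λ k → monomial k α (n ∸ suc D) β (suc j)) coefficient ⟩
      monomial (binom n (suc (suc D)) ℕ.* binom (suc (suc D)) (suc j) ℕ.+ (u ℕ.+ u)) α (n ∸ suc D) β (suc j)
        ≈⟨ trans (monomial-homo-+ _ _ α (n ∸ suc D) β (suc j)) (+-cong refl (monomial-homo-+ u u α (n ∸ suc D) β (suc j))) ⟩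
      monomial (binom n (suc (suc D)) ℕ.* binom (suc (suc D)) (suc j)) α (n ∸ suc D) β (suc j)
        + (monomial u α (n ∸ suc D) β (suc j) + monomial u α (n ∸ suc D) β (suc j))
        ≈⟨ +-cong (monomial-∸-step _ α n (suc D) β (suc j) (λ n≤m → ≡.cong (ℕ._* _) (binom≡0 n (suc (suc D)) (s≤s n≤m))))
                  (trans (+-cong (monomial-sucʳ u α (n ∸ suc D) β j) (monomial-sucʳ u α (n ∸ suc D) β j)) (sym (distribʳ _ β β))) ⟩
      α * t n 0 (suc j) + (β + β) * t n 1 j ∎
      where
      D u : ℕ
      D = double j
      u = binom n (suc D) ℕ.* binom (suc D) j
      coefficient : (binom n (suc D) ℕ.+ binom n (suc (suc D))) ℕ.* binom (suc (suc D)) (suc j)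
                    ≡ binom n (suc (suc D)) ℕ.* binom (suc (suc D)) (suc j) ℕ.+ (u ℕ.+ u)
      coefficient =
        ≡.trans (≡.trans (ℕₚ.*-distribʳ-+ _ (binom n (suc D)) _) (ℕₚ.+-comm (binom n (suc D) ℕ.* binom (suc (suc D)) (suc j)) _))
          (≡.cong (λ v → binom n (suc (suc D)) ℕ.* binom (suc (suc D)) (suc j) ℕ.+ v)
            (≡.trans (≡.cong (λ d → binom n (suc D) ℕ.* (binom (suc D) j ℕ.+ d)) (binom-middle j))
                     (ℕₚ.*-distribˡ-+ (binom n (suc D)) (binom (suc D) j) (binom (suc D) j))))

    trinomial-isTrinomialArray : IsTrinomialArray α β (trinomial α β)
    trinomial-isTrinomialArray = record { initial = initial ; boundary = boundary ; interior = interior }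
      where
      initial : ∀ h → trinomial α β 0 h ≈ δ₀ h
      initial zero    = trans (monomial-constant 1 α β) ⟦1⟧≈1
      initial (suc h) = monomial≈0 α 0 β 0 ≡.refl
      interior : ∀ n h → trinomial α β (suc n) (suc h) ≈ trinomial α β n h + α * trinomial α β n (suc h) + β * trinomial α β n (suc (suc h))
      interior n h = begin
        sumTo (suc n) (t (suc n) (suc h))
          ≈⟨ sumTo-shifted-+′ n _ (λ j → t n h j + α * t n (suc h) j) (λ j → β * t n (suc (suc h)) j)
               (trans (+-cong (trinomialTerm-last n h) (trans (*-cong refl (trinomialTerm-last n (suc h))) (zeroʳ α))) (+-identityʳ 0#))
               (trinomialTerm-interior₀ n h) (λ j _ → trinomialTerm-interior n h j) ⟩
        sumTo n (λ j → t n h j + α * t n (suc h) j) + sumTo n (λ j → β * t n (suc (suc h)) j)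
          ≈⟨ +-cong (sumTo-linear₁ n α _ _) (sym (*-distribˡ-sumTo n β _)) ⟩
        trinomial α β n h + α * trinomial α β n (suc h) + β * trinomial α β n (suc (suc h)) ∎
      boundary : ∀ n → trinomial α β (suc n) 0 ≈ α * trinomial α β n 0 + (β + β) * trinomial α β n 1
      boundary n = begin
        sumTo (suc n) (t (suc n) 0)
          ≈⟨ sumTo-shifted-+′ n _ (λ j → α * t n 0 j) (λ j → (β + β) * t n 1 j)
               (trans (*-cong refl (trinomialTerm-last n 0)) (zeroʳ α)) (trinomialTerm-boundary₀ n) (λ j _ → trinomialTerm-boundary n j) ⟩
        sumTo n (λ j → α * t n 0 j) + sumTo n (λ j → (β + β) * t n 1 j)
          ≈⟨ +-cong (sym (*-distribˡ-sumTo n α _)) (sym (*-distribˡ-sumTo n (β + β) _)) ⟩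
        α * trinomial α β n 0 + (β + β) * trinomial α β n 1 ∎

    motzkinTerm : ℕ → ℕ → Carrier
    motzkinTerm n j = monomial (binom n (double j) ℕ.* catalan j) α (n ∸ double j) β j

    motzkinTerm≈0 : ∀ n j → n < double j → motzkinTerm n j ≈ 0#
    motzkinTerm≈0 n j n<2j = monomial≈0 α _ β j (≡.cong (ℕ._* catalan j) (binom≡0 n (double j) n<2j))

    motzkin≈sumTo-motzkinTerm : ∀ n → motzkin F n α β ≈ sumTo n (motzkinTerm n)
    motzkin≈sumTo-motzkinTerm n = begin
      motzkin F n α β
        ≈⟨ sumTo-cong (n ℕ./ 2) (λ j _ → reflexive (≡.sym (≡.trans (monomial≡ _ α (n ∸ double j) β j)
             (≡.cong₂ (λ k p → ⟦ k ℕ.* catalan j ⟧ * α ^ℕ (n ∸ p) * β ^ℕ j)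
                      (≡.trans (≡.cong (binom n) (double≡2* j)) (binom≡C n (2 ℕ.* j))) (double≡2* j))))) ⟩
      sumTo (n ℕ./ 2) (motzkinTerm n)
        ≈⟨ sumTo-truncate (motzkinTerm n) (m/n≤m n 2)
             (λ j n/2<j → motzkinTerm≈0 n j (≡.subst (n <_) (≡.sym (double≡2* j)) (/2<⇒<2* n j n/2<j))) ⟨
      sumTo n (motzkinTerm n) ∎

    -- The reflection principle: coefficientwise this is catalan-ballot.
    motzkin-reflection : ∀ n → motzkin F n α β + β * trinomial α β n 2 ≈ trinomial α β n 0
    motzkin-reflection n = begin
      motzkin F n α β + β * trinomial α β n 2
        ≈⟨ +-cong (motzkin≈sumTo-motzkinTerm n) (*-distribˡ-sumTo n β _) ⟩
      sumTo n (motzkinTerm n) + sumTo n (λ j → β * t n 2 j)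
        ≈⟨ sumTo-shifted-+′ n (t n 0) (motzkinTerm n) (λ j → β * t n 2 j)
             (motzkinTerm≈0 n (suc n) (s≤s (ℕₚ.m≤n⇒m≤1+n (n≤double n)))) (reflexive ≡.refl) (λ j _ → ballot j) ⟨
      sumTo (suc n) (t n 0)
        ≈⟨ sumTo-dropLast n (t n 0) (trinomialTerm-last n 0) ⟩
      trinomial α β n 0 ∎
      where
      ballot : ∀ j → t n 0 (suc j) ≈ motzkinTerm n (suc j) + β * t n 2 j
      ballot j = begin
        monomial (binom n D ℕ.* binom D (suc j)) α (n ∸ D) β (suc j)
          ≡⟨ ≡.cong (λ k → monomial (binom n D ℕ.* k) α (n ∸ D) β (suc j))
                    (≡.sym (≡.subst (λ m → catalan (suc j) ℕ.+ binom m j ≡ binom m (suc j)) (≡.sym (double≡2* (suc j))) (catalan-ballot j))) ⟩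
        monomial (binom n D ℕ.* (catalan (suc j) ℕ.+ binom D j)) α (n ∸ D) β (suc j)
          ≡⟨ ≡.cong (λ k → monomial k α (n ∸ D) β (suc j)) (ℕₚ.*-distribˡ-+ (binom n D) (catalan (suc j)) (binom D j)) ⟩
        monomial (binom n D ℕ.* catalan (suc j) ℕ.+ binom n D ℕ.* binom D j) α (n ∸ D) β (suc j)
          ≈⟨ monomial-homo-+ _ _ α (n ∸ D) β (suc j) ⟩
        motzkinTerm n (suc j) + monomial (binom n D ℕ.* binom D j) α (n ∸ D) β (suc j)
          ≈⟨ +-cong refl (monomial-sucʳ _ α (n ∸ D) β j) ⟩
        motzkinTerm n (suc j) + β * t n 2 j ∎
        where
        D : ℕ
        D = double (suc j)

  -- z + (x + y) + x y z⁻¹ = (z + x)(1 + y z⁻¹): choose k factors to contribute y z⁻¹ and h + k to contribute z.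
  factoredTerm : Carrier → Carrier → ℕ → ℕ → ℕ → Carrier
  factoredTerm x y n h k = monomial (binom n k ℕ.* binom n (h ℕ.+ k)) x (n ∸ (h ℕ.+ k)) y k

  factored : Carrier → Carrier → ℕ → ℕ → Carrier
  factored x y n h = sumTo n (factoredTerm x y n h)

  module _ (x y : Carrier) where

    private
      g : ℕ → ℕ → ℕ → Carrier
      g = factoredTerm x y

    factoredTerm-last : ∀ n h → g n h (suc n) ≈ 0#
    factoredTerm-last n h = monomial≈0 x _ y (suc n) (≡.cong (ℕ._* binom n (h ℕ.+ suc n)) (binom≡0 n (suc n) ℕₚ.≤-refl))

    factoredTerm-interior₀ : ∀ n h → g (suc n) (suc h) 0 ≈ g n h 0 + x * g n (suc h) 0
    factoredTerm-interior₀ n h = begin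
      monomial (1 ℕ.* (binom n m ℕ.+ binom n (suc m))) x (n ∸ m) y 0
        ≡⟨ ≡.cong (λ k → monomial k x (n ∸ m) y 0) (ℕₚ.*-distribˡ-+ 1 (binom n m) (binom n (suc m))) ⟩
      monomial (1 ℕ.* binom n m ℕ.+ 1 ℕ.* binom n (suc m)) x (n ∸ m) y 0
        ≈⟨ monomial-homo-+ _ _ x (n ∸ m) y 0 ⟩
      g n h 0 + monomial (1 ℕ.* binom n (suc m)) x (n ∸ m) y 0
        ≈⟨ +-cong refl (monomial-∸-step _ x n m y 0 (λ n≤m → ≡.cong (1 ℕ.*_) (binom≡0 n (suc m) (s≤s n≤m)))) ⟩
      g n h 0 + x * g n (suc h) 0 ∎
      where
      m : ℕ
      m = h ℕ.+ 0

    factoredTerm-interior : ∀ n h k →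
      g (suc n) (suc h) (suc k) ≈ (g n h (suc k) + x * g n (suc h) (suc k)) + (y * g n (suc h) k + (x * y) * g n (suc (suc h)) k)
    factoredTerm-interior n h k = begin
      monomial ((a ℕ.+ b) ℕ.* (u ℕ.+ v)) x (n ∸ m) y (suc k)
        ≡⟨ ≡.cong (λ l → monomial l x (n ∸ m) y (suc k)) (split a b u v) ⟩
      monomial (b ℕ.* u ℕ.+ b ℕ.* v ℕ.+ (a ℕ.* u ℕ.+ a ℕ.* v)) x (n ∸ m) y (suc k)
        ≈⟨ trans (monomial-homo-+ _ _ x (n ∸ m) y (suc k))
                 (+-cong (monomial-homo-+ _ _ x (n ∸ m) y (suc k)) (monomial-homo-+ _ _ x (n ∸ m) y (suc k))) ⟩
      (g n h (suc k) + monomial (b ℕ.* v) x (n ∸ m) y (suc k))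
        + (monomial (a ℕ.* u) x (n ∸ m) y (suc k) + monomial (a ℕ.* v) x (n ∸ m) y (suc k))
        ≈⟨ +-cong (+-cong refl (monomial-∸-step _ x n m y (suc k) (vanish b)))
                  (+-cong (monomial-sucʳ _ x (n ∸ m) y k)
                          (trans (monomial-sucʳ _ x (n ∸ m) y k) (*-cong refl (monomial-∸-step _ x n m y k (vanish a))))) ⟩
      (g n h (suc k) + x * g n (suc h) (suc k))
        + (y * monomial (a ℕ.* u) x (n ∸ m) y k + y * (x * monomial (a ℕ.* v) x (n ∸ suc m) y k))
        ≈⟨ +-cong refl (+-cong (*-cong refl (reflexive (≡.cong (λ l → monomial (a ℕ.* binom n l) x (n ∸ l) y k) shift)))
                                (trans (x∙yz≈xy∙z y x _) (*-cong (*-comm y x)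
                                  (reflexive (≡.cong (λ l → monomial (a ℕ.* binom n (suc l)) x (n ∸ suc l) y k) shift))))) ⟩
      (g n h (suc k) + x * g n (suc h) (suc k)) + (y * g n (suc h) k + (x * y) * g n (suc (suc h)) k) ∎
      where
      m a b u v : ℕ
      m = h ℕ.+ suc k
      a = binom n k
      b = binom n (suc k)
      u = binom n m
      v = binom n (suc m)
      shift : m ≡ suc h ℕ.+ k
      shift = ℕₚ.+-suc h k
      vanish : ∀ e → n ≤ m → e ℕ.* v ≡ 0
      vanish e n≤m = ≡.trans (≡.cong (e ℕ.*_) (binom≡0 n (suc m) (s≤s n≤m))) (ℕₚ.*-zeroʳ e)
      split : ∀ a b u v → (a ℕ.+ b) ℕ.* (u ℕ.+ v) ≡ b ℕ.* u ℕ.+ b ℕ.* v ℕ.+ (a ℕ.* u ℕ.+ a ℕ.* v)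
      split = solve-∀

    factoredTerm-boundary₀ : ∀ n → g (suc n) 0 0 ≈ x * g n 0 0
    factoredTerm-boundary₀ n = monomial-∸-step _ x (suc n) 0 y 0 (λ ())

    factoredTerm-boundary : ∀ n k → g (suc n) 0 (suc k) ≈ x * g n 0 (suc k) + (y * g n 0 k + (x * y + x * y) * g n 1 k)
    factoredTerm-boundary n k = begin
      monomial ((a ℕ.+ b) ℕ.* (a ℕ.+ b)) x (n ∸ k) y (suc k)
        ≡⟨ ≡.cong (λ l → monomial l x (n ∸ k) y (suc k)) (split a b) ⟩
      monomial (b ℕ.* b ℕ.+ (a ℕ.* a ℕ.+ (a ℕ.* b ℕ.+ a ℕ.* b))) x (n ∸ k) y (suc k)
        ≈⟨ trans (monomial-homo-+ _ _ x (n ∸ k) y (suc k))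
                 (+-cong refl (trans (monomial-homo-+ _ _ x (n ∸ k) y (suc k)) (+-cong refl (monomial-homo-+ _ _ x (n ∸ k) y (suc k))))) ⟩
      monomial (b ℕ.* b) x (n ∸ k) y (suc k)
        + (monomial (a ℕ.* a) x (n ∸ k) y (suc k) + (monomial (a ℕ.* b) x (n ∸ k) y (suc k) + monomial (a ℕ.* b) x (n ∸ k) y (suc k)))
        ≈⟨ +-cong (monomial-∸-step _ x n k y (suc k) (vanish b))
                  (+-cong (monomial-sucʳ _ x (n ∸ k) y k) (+-cong mixed mixed)) ⟩
      x * g n 0 (suc k) + (y * g n 0 k + ((x * y) * g n 1 k + (x * y) * g n 1 k))
        ≈⟨ +-cong refl (+-cong refl (sym (distribʳ _ (x * y) (x * y)))) ⟩
      x * g n 0 (suc k) + (y * g n 0 k + (x * y + x * y) * g n 1 k) ∎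
      where
      a b : ℕ
      a = binom n k
      b = binom n (suc k)
      vanish : ∀ e → n ≤ k → e ℕ.* b ≡ 0
      vanish e n≤k = ≡.trans (≡.cong (e ℕ.*_) (binom≡0 n (suc k) (s≤s n≤k))) (ℕₚ.*-zeroʳ e)
      mixed : monomial (a ℕ.* b) x (n ∸ k) y (suc k) ≈ (x * y) * g n 1 k
      mixed = trans (monomial-sucʳ _ x (n ∸ k) y k)
                (trans (*-cong refl (monomial-∸-step _ x n k y k (vanish a))) (trans (sym (*-assoc y x _)) (*-cong (*-comm y x) refl)))
      split : ∀ a b → (a ℕ.+ b) ℕ.* (a ℕ.+ b) ≡ b ℕ.* b ℕ.+ (a ℕ.* a ℕ.+ (a ℕ.* b ℕ.+ a ℕ.* b))
      split = solve-∀

    factored-isTrinomialArray : ∀ {α β} → α ≈ x + y → β ≈ x * y → IsTrinomialArray α β (factored x y)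
    factored-isTrinomialArray {α} {β} α≈x+y β≈xy = record { initial = initial ; boundary = boundary ; interior = interior }
      where
      G : ℕ → ℕ → Carrier
      G = factored x y
      initial : ∀ h → G 0 h ≈ δ₀ h
      initial zero    = trans (monomial-constant 1 x y) ⟦1⟧≈1
      initial (suc h) = monomial≈0 x 0 y 0 ≡.refl
      interior : ∀ n h → G (suc n) (suc h) ≈ G n h + α * G n (suc h) + β * G n (suc (suc h))
      interior n h = begin
        sumTo (suc n) (g (suc n) (suc h))
          ≈⟨ sumTo-shifted-+′ n _ (λ k → g n h k + x * g n (suc h) k) (λ k → y * g n (suc h) k + (x * y) * g n (suc (suc h)) k)
               (trans (+-cong (factoredTerm-last n h) (trans (*-cong refl (factoredTerm-last n (suc h))) (zeroʳ x))) (+-identityʳ 0#))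
               (factoredTerm-interior₀ n h) (λ k _ → factoredTerm-interior n h k) ⟩
        sumTo n (λ k → g n h k + x * g n (suc h) k) + sumTo n (λ k → y * g n (suc h) k + (x * y) * g n (suc (suc h)) k)
          ≈⟨ +-cong (sumTo-linear₁ n x _ _) (sumTo-linear n y (x * y) _ _) ⟩
        G n h + x * G n (suc h) + (y * G n (suc h) + (x * y) * G n (suc (suc h)))
          ≈⟨ collect (G n h) (G n (suc h)) (G n (suc (suc h))) x y (x * y) ⟩
        G n h + (x + y) * G n (suc h) + (x * y) * G n (suc (suc h))
          ≈⟨ +-cong (+-cong refl (*-cong (sym α≈x+y) refl)) (*-cong (sym β≈xy) refl) ⟩
        G n h + α * G n (suc h) + β * G n (suc (suc h)) ∎
        where
        collect : ∀ a b e x y z → a + x * b + (y * b + z * e) ≈ a + (x + y) * b + z * e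
        collect = solve 6 (λ a b e x y z → a :+ x :* b :+ (y :* b :+ z :* e) := a :+ (x :+ y) :* b :+ z :* e) refl
      boundary : ∀ n → G (suc n) 0 ≈ α * G n 0 + (β + β) * G n 1
      boundary n = begin
        sumTo (suc n) (g (suc n) 0)
          ≈⟨ sumTo-shifted-+′ n _ (λ k → x * g n 0 k) (λ k → y * g n 0 k + (x * y + x * y) * g n 1 k)
               (trans (*-cong refl (factoredTerm-last n 0)) (zeroʳ x)) (factoredTerm-boundary₀ n) (λ k _ → factoredTerm-boundary n k) ⟩
        sumTo n (λ k → x * g n 0 k) + sumTo n (λ k → y * g n 0 k + (x * y + x * y) * g n 1 k)
          ≈⟨ +-cong (sym (*-distribˡ-sumTo n x _)) (sumTo-linear n y (x * y + x * y) _ _) ⟩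
        x * G n 0 + (y * G n 0 + (x * y + x * y) * G n 1)
          ≈⟨ trans (sym (+-assoc _ _ _)) (+-cong (sym (distribʳ _ x y)) refl) ⟩
        (x + y) * G n 0 + (x * y + x * y) * G n 1
          ≈⟨ +-cong (*-cong (sym α≈x+y) refl) (*-cong (+-cong (sym β≈xy) (sym β≈xy)) refl) ⟩
        α * G n 0 + (β + β) * G n 1 ∎

  module _ {x : Carrier} (x*x⁻¹≈1 : x * x ⁻¹ ≈ 1#) where

    ^ℕ-inverse : ∀ d → (x ⁻¹) ^ℕ d * x ^ℕ d ≈ 1#
    ^ℕ-inverse zero    = *-identityˡ 1#
    ^ℕ-inverse (suc d) = begin
      x ⁻¹ * (x ⁻¹) ^ℕ d * (x * x ^ℕ d)   ≈⟨ *-interchange (x ⁻¹) _ x _ ⟩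
      x ⁻¹ * x * ((x ⁻¹) ^ℕ d * x ^ℕ d)   ≈⟨ *-cong (trans (*-comm _ _) x*x⁻¹≈1) (^ℕ-inverse d) ⟩
      1# * 1#                             ≈⟨ *-identityˡ 1# ⟩
      1#                                  ∎

    ^ℤ-⊖ : ∀ a b → x ^ℤ (a ℤ.⊖ b) * x ^ℕ b ≈ x ^ℕ a
    ^ℤ-⊖ a       zero    = *-identityʳ _
    ^ℤ-⊖ zero    (suc b) = ^ℕ-inverse (suc b)
    ^ℤ-⊖ (suc a) (suc b) = begin
      x ^ℤ (suc a ℤ.⊖ suc b) * (x * x ^ℕ b) ≡⟨ ≡.cong (λ i → x ^ℤ i * (x * x ^ℕ b)) ([1+m]⊖[1+n]≡m⊖n a b) ⟩
      x ^ℤ (a ℤ.⊖ b) * (x * x ^ℕ b)         ≈⟨ x∙yz≈y∙xz _ x _ ⟩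
      x * (x ^ℤ (a ℤ.⊖ b) * x ^ℕ b)         ≈⟨ *-cong refl (^ℤ-⊖ a b) ⟩
      x * x ^ℕ a                            ∎

    ^ℤ-[n-2k]*^k : ∀ {n k} → k ≤ n → x ^ℤ ((ℤ.+ n) ℤ.- (ℤ.+ (2 ℕ.* k))) * x ^ℕ k ≈ x ^ℕ (n ∸ k)
    ^ℤ-[n-2k]*^k {n} {k} k≤n = trans (reflexive (≡.cong (λ i → x ^ℤ i * x ^ℕ k) exponent)) (^ℤ-⊖ (n ∸ k) k)
      where
      exponent : (ℤ.+ n) ℤ.- (ℤ.+ (2 ℕ.* k)) ≡ (n ∸ k) ℤ.⊖ k
      exponent = ≡.trans ([+m]-[+n]≡m⊖n n (2 ℕ.* k))
                   (≡.trans (≡.cong₂ ℤ._⊖_ (≡.sym (ℕₚ.m+[n∸m]≡n k≤n)) (≡.cong (k ℕ.+_) (ℕₚ.+-identityʳ k)))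
                            (+-cancelˡ-⊖ k (n ∸ k) k))

    ^ℕ-cancel : ∀ {m k} → k ≤ m → x ^ℕ m * (x ⁻¹) ^ℕ k ≈ x ^ℕ (m ∸ k)
    ^ℕ-cancel {m} {k} k≤m = begin
      x ^ℕ m * (x ⁻¹) ^ℕ k                    ≡⟨ ≡.cong (λ l → x ^ℕ l * (x ⁻¹) ^ℕ k) (≡.sym (ℕₚ.m+[n∸m]≡n k≤m)) ⟩
      x ^ℕ (k ℕ.+ (m ∸ k)) * (x ⁻¹) ^ℕ k      ≈⟨ *-cong (^ℕ-homo-* x k (m ∸ k)) refl ⟩
      x ^ℕ k * x ^ℕ (m ∸ k) * (x ⁻¹) ^ℕ k     ≈⟨ xy∙z≈zx∙y _ _ _ ⟩
      (x ⁻¹) ^ℕ k * x ^ℕ k * x ^ℕ (m ∸ k)     ≈⟨ *-cong (^ℕ-inverse k) refl ⟩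
      1# * x ^ℕ (m ∸ k)                       ≈⟨ *-identityˡ _ ⟩
      x ^ℕ (m ∸ k)                            ∎

  ⟦⟧-divide : ∀ n a e b → a ℕ.+ suc n ℕ.* e ≡ suc n ℕ.* b → ⟦ suc n ⟧ ⁻¹ * ⟦ a ⟧ + ⟦ e ⟧ ≈ ⟦ b ⟧
  ⟦⟧-divide n a e b a+Ne≡Nb = begin
    I * ⟦ a ⟧ + ⟦ e ⟧                   ≈⟨ +-cong refl (cancel ⟦ e ⟧) ⟨
    I * ⟦ a ⟧ + I * (N * ⟦ e ⟧)         ≈⟨ distribˡ I _ _ ⟨
    I * (⟦ a ⟧ + N * ⟦ e ⟧)             ≈⟨ *-cong refl (trans (⟦⟧-homo-+ a (suc n ℕ.* e)) (+-cong refl (⟦⟧-homo-* (suc n) e))) ⟨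
    I * ⟦ a ℕ.+ suc n ℕ.* e ⟧           ≡⟨ ≡.cong (λ k → I * ⟦ k ⟧) a+Ne≡Nb ⟩
    I * ⟦ suc n ℕ.* b ⟧                 ≈⟨ *-cong refl (⟦⟧-homo-* (suc n) b) ⟩
    I * (N * ⟦ b ⟧)                     ≈⟨ cancel ⟦ b ⟧ ⟩
    ⟦ b ⟧                               ∎
    where
    N I : Carrier
    N = ⟦ suc n ⟧
    I = N ⁻¹
    cancel : ∀ z → I * (N * z) ≈ z
    cancel z = trans (sym (*-assoc I N z)) (trans (*-cong (trans (*-comm I N) (⁻¹-inverse N (char-zero n))) refl) (*-identityˡ z))

  opaque
    unfolding monomial

    monomial-divide : ∀ n a e b u p v q → a ℕ.+ suc n ℕ.* e ≡ suc n ℕ.* b →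
                      ⟦ suc n ⟧ ⁻¹ * monomial a u p v q + monomial e u p v q ≈ monomial b u p v q
    monomial-divide n a e b u p v q a+Ne≡Nb = begin
      ⟦ suc n ⟧ ⁻¹ * (⟦ a ⟧ * u ^ℕ p * v ^ℕ q) + ⟦ e ⟧ * u ^ℕ p * v ^ℕ q
        ≈⟨ +-cong (trans (sym (*-assoc _ _ _)) (*-cong (sym (*-assoc _ _ _)) refl)) refl ⟩
      ⟦ suc n ⟧ ⁻¹ * ⟦ a ⟧ * u ^ℕ p * v ^ℕ q + ⟦ e ⟧ * u ^ℕ p * v ^ℕ q
        ≈⟨ trans (sym (distribʳ _ _ _)) (*-cong (sym (distribʳ _ _ _)) refl) ⟩
      (⟦ suc n ⟧ ⁻¹ * ⟦ a ⟧ + ⟦ e ⟧) * u ^ℕ p * v ^ℕ q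
        ≈⟨ *-cong (*-cong (⟦⟧-divide n a e b a+Ne≡Nb) refl) refl ⟩
      ⟦ b ⟧ * u ^ℕ p * v ^ℕ q ∎

  narayanaTerm : Carrier → Carrier → ℕ → ℕ → Carrier
  narayanaTerm x β n k = (x ^ℤ ((ℤ.+ n) ℤ.- (ℤ.+ (2 ℕ.* k)))) * ((β ^ℕ k) ÷ ⟦ suc n ⟧) * ⟦ (suc n C k) ℕ.* (suc n C suc k) ⟧

  narayanaSum : Carrier → Carrier → ℕ → Carrier
  narayanaSum x β n = sumTo (suc n) (narayanaTerm x β n)

  module _ {x y β : Carrier} (x*x⁻¹≈1 : x * x ⁻¹ ≈ 1#) (β≈xy : β ≈ x * y) where

    private
      p : ℕ → ℕ → Carrier
      p = narayanaTerm x β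
      g : ℕ → ℕ → ℕ → Carrier
      g = factoredTerm x y

    narayanaTerm≈monomial : ∀ n k → k ≤ suc n →
      p n k ≈ ⟦ suc n ⟧ ⁻¹ * monomial (binom (suc n) k ℕ.* binom (suc n) (suc k)) x (n ∸ k) y k
    narayanaTerm≈monomial n k k≤1+n with ℕₚ.m≤n⇒m<n∨m≡n k≤1+n
    ... | inj₁ (s≤s k≤n) = begin
      X * (β ^ℕ k * I) * ⟦ (suc n C k) ℕ.* (suc n C suc k) ⟧
        ≈⟨ *-cong (*-cong refl (*-cong (trans (^ℕ-congˡ k β≈xy) (^ℕ-distrib-* x y k)) refl))
                  (reflexive (≡.cong ⟦_⟧ (≡.sym (≡.cong₂ ℕ._*_ (binom≡C (suc n) k) (binom≡C (suc n) (suc k)))))) ⟩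
      X * (x ^ℕ k * y ^ℕ k * I) * ⟦ N ⟧ ≈⟨ regroup X (x ^ℕ k) (y ^ℕ k) I ⟦ N ⟧ ⟩
      I * (⟦ N ⟧ * (X * x ^ℕ k) * y ^ℕ k) ≈⟨ *-cong refl (*-cong (*-cong refl (^ℤ-[n-2k]*^k x*x⁻¹≈1 k≤n)) refl) ⟩
      I * (⟦ N ⟧ * x ^ℕ (n ∸ k) * y ^ℕ k) ≡⟨ ≡.cong (I *_) (≡.sym (monomial≡ N x (n ∸ k) y k)) ⟩
      I * monomial N x (n ∸ k) y k ∎
      where
      X I : Carrier
      X = x ^ℤ ((ℤ.+ n) ℤ.- (ℤ.+ (2 ℕ.* k)))
      I = ⟦ suc n ⟧ ⁻¹
      N : ℕ
      N = binom (suc n) k ℕ.* binom (suc n) (suc k)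
      regroup : ∀ a b e i m → a * (b * e * i) * m ≈ i * (m * (a * b) * e)
      regroup = solve 5 (λ a b e i m → a :* (b :* e :* i) :* m := i :* (m :* (a :* b) :* e)) refl
    ... | inj₂ ≡.refl = trans (trans (*-cong refl (reflexive (≡.cong ⟦_⟧ coefficient≡0))) (zeroʳ _))
                              (sym (trans (*-cong refl (monomial≈0 x _ y (suc n) monomial-coefficient≡0)) (zeroʳ _)))
      where
      C[1+n,2+n]≡0 : binom (suc n) (suc (suc n)) ≡ 0
      C[1+n,2+n]≡0 = binom≡0 (suc n) (suc (suc n)) ℕₚ.≤-refl
      coefficient≡0 : (suc n C suc n) ℕ.* (suc n C suc (suc n)) ≡ 0
      coefficient≡0 = ≡.trans (≡.cong ((suc n C suc n) ℕ.*_) (≡.trans (≡.sym (binom≡C (suc n) (suc (suc n)))) C[1+n,2+n]≡0)) (ℕₚ.*-zeroʳ (suc n C suc n))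
      monomial-coefficient≡0 : binom (suc n) (suc n) ℕ.* binom (suc n) (suc (suc n)) ≡ 0
      monomial-coefficient≡0 = ≡.trans (≡.cong (binom (suc n) (suc n) ℕ.*_) C[1+n,2+n]≡0) (ℕₚ.*-zeroʳ (binom (suc n) (suc n)))

    narayanaTerm-last : ∀ n → p n (suc n) ≈ 0#
    narayanaTerm-last n = trans (narayanaTerm≈monomial n (suc n) ℕₚ.≤-refl)
      (trans (*-cong refl (monomial≈0 x _ y (suc n) (≡.trans (≡.cong (binom (suc n) (suc n) ℕ.*_) (binom≡0 (suc n) (suc (suc n)) ℕₚ.≤-refl))
                                                          (ℕₚ.*-zeroʳ (binom (suc n) (suc n)))))) (zeroʳ _))

    -- Coefficientwise this is narayana-minor.
    narayana-reflection : ∀ n → narayanaSum x β n + β * factored x y n 2 ≈ factored x y n 0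
    narayana-reflection n = begin
      sumTo (suc n) (p n) + β * factored x y n 2
        ≈⟨ +-cong (sumTo-dropLast n (p n) (narayanaTerm-last n)) (*-distribˡ-sumTo n β (g n 2)) ⟩
      sumTo n (p n) + sumTo n (λ k → β * g n 2 k)
        ≈⟨ sumTo-shifted-+′ n (g n 0) (p n) (λ k → β * g n 2 k) (narayanaTerm-last n) head tail ⟨
      sumTo (suc n) (g n 0)
        ≈⟨ sumTo-dropLast n (g n 0) (factoredTerm-last x y n 0) ⟩
      factored x y n 0 ∎
      where
      head : g n 0 0 ≈ p n 0
      head = sym (begin
        p n 0                                                      ≈⟨ narayanaTerm≈monomial n 0 z≤n ⟩
        ⟦ suc n ⟧ ⁻¹ * monomial (1 ℕ.* binom (suc n) 1) x n y 0     ≈⟨ +-identityʳ _ ⟨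
        ⟦ suc n ⟧ ⁻¹ * monomial (1 ℕ.* binom (suc n) 1) x n y 0 + 0# ≈⟨ +-cong refl (monomial≈0 x n y 0 ≡.refl) ⟨
        ⟦ suc n ⟧ ⁻¹ * monomial (1 ℕ.* binom (suc n) 1) x n y 0 + monomial 0 x n y 0
          ≈⟨ monomial-divide n (1 ℕ.* binom (suc n) 1) 0 (1 ℕ.* 1) x n y 0 row₀ ⟩
        g n 0 0 ∎)
        where
        row₀ : 1 ℕ.* binom (suc n) 1 ℕ.+ suc n ℕ.* 0 ≡ suc n ℕ.* (1 ℕ.* 1)
        row₀ = ≡.trans (≡.cong₂ ℕ._+_ (≡.trans (ℕₚ.*-identityˡ _) (binom[n,1]≡n (suc n))) (ℕₚ.*-zeroʳ (suc n)))
                       (≡.trans (ℕₚ.+-identityʳ (suc n)) (≡.sym (ℕₚ.*-identityʳ (suc n))))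
      tail : ∀ k → k ≤ n → g n 0 (suc k) ≈ p n (suc k) + β * g n 2 k
      tail k k≤n = sym (begin
        p n (suc k) + β * g n 2 k
          ≈⟨ +-cong (narayanaTerm≈monomial n (suc k) (s≤s k≤n)) lowered ⟩
        ⟦ suc n ⟧ ⁻¹ * monomial (binom (suc n) (suc k) ℕ.* binom (suc n) (suc (suc k))) x (n ∸ suc k) y (suc k)
          + monomial (binom n k ℕ.* binom n (suc (suc k))) x (n ∸ suc k) y (suc k)
          ≈⟨ monomial-divide n _ _ _ x (n ∸ suc k) y (suc k) (narayana-minor n k) ⟩
        g n 0 (suc k) ∎)
        where
        lowered : β * g n 2 k ≈ monomial (binom n k ℕ.* binom n (suc (suc k))) x (n ∸ suc k) y (suc k)
        lowered = begin
          β * g n 2 k       ≈⟨ *-cong β≈xy refl ⟩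
          x * y * g n 2 k   ≈⟨ xy∙z≈y∙xz x y _ ⟩
          y * (x * g n 2 k) ≈⟨ *-cong refl (monomial-∸-step _ x n (suc k) y k
                                 (λ n≤1+k → ≡.trans (≡.cong (binom n k ℕ.*_) (binom≡0 n (suc (suc k)) (s≤s n≤1+k))) (ℕₚ.*-zeroʳ (binom n k)))) ⟨
          y * monomial (binom n k ℕ.* binom n (suc (suc k))) x (n ∸ suc k) y k
                            ≈⟨ monomial-sucʳ _ x (n ∸ suc k) y k ⟨
          monomial (binom n k ℕ.* binom n (suc (suc k))) x (n ∸ suc k) y (suc k) ∎

    motzkin≈narayanaSum : ∀ {α} → α ≈ x + y → ∀ n → motzkin F n α β ≈ narayanaSum x β n
    motzkin≈narayanaSum {α} α≈x+y n = +-cancelʳ (β * trinomial α β n 2) _ _ (begin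
      motzkin F n α β + β * trinomial α β n 2      ≈⟨ motzkin-reflection α β n ⟩
      trinomial α β n 0                            ≈⟨ agree n 0 ⟩
      factored x y n 0                             ≈⟨ narayana-reflection n ⟨
      narayanaSum x β n + β * factored x y n 2     ≈⟨ +-cong refl (*-cong refl (agree n 2)) ⟨
      narayanaSum x β n + β * trinomial α β n 2    ∎)
      where
      agree : ∀ n h → trinomial α β n h ≈ factored x y n h
      agree = trinomialArray-unique (trinomial-isTrinomialArray α β) (factored-isTrinomialArray x y α≈x+y β≈xy)

  shift : (ℕ → Carrier) → ℕ → Carrier
  shift p zero    = 0#
  shift p (suc N) = p N

  shift-cong : ∀ {p q : ℕ → Carrier} → (∀ N → p N ≈ q N) → ∀ N → shift p N ≈ shift q N
  shift-cong p≈q zero    = refl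
  shift-cong p≈q (suc N) = p≈q N

  -- mixedProduct s y a b N is the coefficient of zᴺ in (z + y + s)ᵃ (z + y)ᵇ, with the first factor expanded in powers of s.
  mixedTerm : Carrier → Carrier → ℕ → ℕ → ℕ → ℕ → Carrier
  mixedTerm s y a b N i = monomial (binom a i ℕ.* binom (b ℕ.+ i) N) s (a ∸ i) y ((b ℕ.+ i) ∸ N)

  mixedProduct : Carrier → Carrier → ℕ → ℕ → ℕ → Carrier
  mixedProduct s y a b N = sumTo a (mixedTerm s y a b N)

  module _ (s y : Carrier) where

    private
      r : ℕ → ℕ → ℕ → ℕ → Carrier
      r = mixedTerm s y
      R : ℕ → ℕ → ℕ → Carrier
      R = mixedProduct s y

    mixedTerm-last : ∀ a b N → r a b N (suc a) ≈ 0#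
    mixedTerm-last a b N = monomial≈0 s _ y _ (≡.cong (ℕ._* binom (b ℕ.+ suc a) N) (binom≡0 a (suc a) ℕₚ.≤-refl))

    mixedProduct-sucʳ : ∀ a b N → R a (suc b) N ≈ shift (R a b) N + y * R a b N
    mixedProduct-sucʳ a b zero = begin
      R a (suc b) 0        ≈⟨ sumTo-cong a (λ i _ → monomial-sucʳ _ s (a ∸ i) y (b ℕ.+ i)) ⟩
      sumTo a (λ i → y * r a b 0 i) ≈⟨ *-distribˡ-sumTo a y _ ⟨
      y * R a b 0          ≈⟨ +-identityˡ _ ⟨
      0# + y * R a b 0     ∎
    mixedProduct-sucʳ a b (suc N) = trans (sumTo-cong a (λ i _ → term i)) (sumTo-linear₁ a y _ _)
      where
      term : ∀ i → r a (suc b) (suc N) i ≈ r a b N i + y * r a b (suc N) i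
      term i = begin
        monomial (binom a i ℕ.* (binom (b ℕ.+ i) N ℕ.+ binom (b ℕ.+ i) (suc N))) s (a ∸ i) y ((b ℕ.+ i) ∸ N)
          ≡⟨ ≡.cong (λ k → monomial k s (a ∸ i) y ((b ℕ.+ i) ∸ N)) (ℕₚ.*-distribˡ-+ (binom a i) _ _) ⟩
        monomial (binom a i ℕ.* binom (b ℕ.+ i) N ℕ.+ binom a i ℕ.* binom (b ℕ.+ i) (suc N)) s (a ∸ i) y ((b ℕ.+ i) ∸ N)
          ≈⟨ monomial-homo-+ _ _ s (a ∸ i) y ((b ℕ.+ i) ∸ N) ⟩
        r a b N i + monomial (binom a i ℕ.* binom (b ℕ.+ i) (suc N)) s (a ∸ i) y ((b ℕ.+ i) ∸ N)
          ≈⟨ +-cong refl (monomial-∸-stepʳ _ s (a ∸ i) y (b ℕ.+ i) N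
               (λ b+i≤N → ≡.trans (≡.cong (binom a i ℕ.*_) (binom≡0 (b ℕ.+ i) (suc N) (s≤s b+i≤N))) (ℕₚ.*-zeroʳ (binom a i)))) ⟩
        r a b N i + y * r a b (suc N) i ∎

    mixedProduct-sucˡ : ∀ a b N → R (suc a) b N ≈ s * R a b N + R a (suc b) N
    mixedProduct-sucˡ a b N = begin
      R (suc a) b N
        ≈⟨ sumTo-shifted-+′ a (r (suc a) b N) (λ i → s * r a b N i) (r a (suc b) N)
             (trans (*-cong refl (mixedTerm-last a b N)) (zeroʳ s)) (monomial-∸-step _ s (suc a) 0 y ((b ℕ.+ 0) ∸ N) (λ ()))
             (λ i _ → term i) ⟩
      sumTo a (λ i → s * r a b N i) + R a (suc b) N
        ≈⟨ +-cong (*-distribˡ-sumTo a s _) refl ⟨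
      s * R a b N + R a (suc b) N ∎
      where
      term : ∀ i → r (suc a) b N (suc i) ≈ s * r a b N (suc i) + r a (suc b) N i
      term i = begin
        monomial ((binom a i ℕ.+ binom a (suc i)) ℕ.* binom (b ℕ.+ suc i) N) s (a ∸ i) y ((b ℕ.+ suc i) ∸ N)
          ≡⟨ ≡.cong (λ k → monomial k s (a ∸ i) y ((b ℕ.+ suc i) ∸ N)) (ℕₚ.*-distribʳ-+ (binom (b ℕ.+ suc i) N) (binom a i) _) ⟩
        monomial (binom a i ℕ.* binom (b ℕ.+ suc i) N ℕ.+ binom a (suc i) ℕ.* binom (b ℕ.+ suc i) N) s (a ∸ i) y ((b ℕ.+ suc i) ∸ N)
          ≈⟨ monomial-homo-+ _ _ s (a ∸ i) y ((b ℕ.+ suc i) ∸ N) ⟩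
        monomial (binom a i ℕ.* binom (b ℕ.+ suc i) N) s (a ∸ i) y ((b ℕ.+ suc i) ∸ N)
          + monomial (binom a (suc i) ℕ.* binom (b ℕ.+ suc i) N) s (a ∸ i) y ((b ℕ.+ suc i) ∸ N)
          ≈⟨ +-comm _ _ ⟩
        monomial (binom a (suc i) ℕ.* binom (b ℕ.+ suc i) N) s (a ∸ i) y ((b ℕ.+ suc i) ∸ N)
          + monomial (binom a i ℕ.* binom (b ℕ.+ suc i) N) s (a ∸ i) y ((b ℕ.+ suc i) ∸ N)
          ≈⟨ +-cong (monomial-∸-step _ s a i y _
                       (λ a≤i → ≡.cong (ℕ._* binom (b ℕ.+ suc i) N) (binom≡0 a (suc i) (s≤s a≤i))))
                    (reflexive (≡.cong (λ m → monomial (binom a i ℕ.* binom m N) s (a ∸ i) y (m ∸ N)) (ℕₚ.+-suc b i))) ⟩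
        s * r a b N (suc i) + r a (suc b) N i ∎

    mixedProduct-sucˡ′ : ∀ {x} → x ≈ y + s → ∀ a b N → R (suc a) b N ≈ shift (R a b) N + x * R a b N
    mixedProduct-sucˡ′ {x} x≈y+s a b N = begin
      R (suc a) b N                                  ≈⟨ mixedProduct-sucˡ a b N ⟩
      s * R a b N + R a (suc b) N                    ≈⟨ +-cong refl (mixedProduct-sucʳ a b N) ⟩
      s * R a b N + (shift (R a b) N + y * R a b N)  ≈⟨ regroup s (R a b N) (shift (R a b) N) y ⟩
      shift (R a b) N + (y + s) * R a b N            ≈⟨ +-cong refl (*-cong (sym x≈y+s) refl) ⟩
      shift (R a b) N + x * R a b N                  ∎
      where
      regroup : ∀ s r h y → s * r + (h + y * r) ≈ h + (y + s) * r
      regroup = solve 4 (λ s r h y → s :* r :+ (h :+ y :* r) := h :+ (y :+ s) :* r) refl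

    quadraticPower : ℕ → ℕ → Carrier
    quadraticPower n = R n n

    private
      P : ℕ → ℕ → Carrier
      P = quadraticPower

    quadraticPower-initial : ∀ N → P 0 N ≈ δ₀ N
    quadraticPower-initial zero    = trans (monomial-constant 1 s y) ⟦1⟧≈1
    quadraticPower-initial (suc N) = monomial≈0 s 0 y 0 ≡.refl

    quadraticPower-vanishes : ∀ n N → n ℕ.+ n < N → P n N ≈ 0#
    quadraticPower-vanishes n N 2n<N = sumTo≈0 n (λ i i≤n → monomial≈0 s (n ∸ i) y _
      (≡.trans (≡.cong (binom n i ℕ.*_) (binom≡0 (n ℕ.+ i) N (ℕₚ.≤-<-trans (ℕₚ.+-monoʳ-≤ n i≤n) 2n<N))) (ℕₚ.*-zeroʳ (binom n i))))

    module _ {x α β : Carrier} (x≈y+s : x ≈ y + s) (α≈x+y : α ≈ x + y) (β≈xy : β ≈ x * y) where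

      quadraticPower-suc : ∀ n N → P (suc n) N ≈ shift (shift (P n)) N + α * shift (P n) N + β * P n N
      quadraticPower-suc n N = begin
        R (suc n) (suc n) N
          ≈⟨ mixedProduct-sucˡ′ x≈y+s n (suc n) N ⟩
        shift (R n (suc n)) N + x * R n (suc n) N
          ≈⟨ +-cong (shift-cong (mixedProduct-sucʳ n n) N) (*-cong refl (mixedProduct-sucʳ n n N)) ⟩
        shift (λ M → shift (P n) M + y * P n M) N + x * (shift (P n) N + y * P n N)
          ≈⟨ +-cong (shift-linear N) refl ⟩
        (shift (shift (P n)) N + y * shift (P n) N) + x * (shift (P n) N + y * P n N)
          ≈⟨ regroup _ _ _ x y ⟩
        shift (shift (P n)) N + (x + y) * shift (P n) N + (x * y) * P n N
          ≈⟨ +-cong (+-cong refl (*-cong (sym α≈x+y) refl)) (*-cong (sym β≈xy) refl) ⟩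
        shift (shift (P n)) N + α * shift (P n) N + β * P n N ∎
        where
        shift-linear : ∀ N → shift (λ M → shift (P n) M + y * P n M) N ≈ shift (shift (P n)) N + y * shift (P n) N
        shift-linear zero    = sym (trans (+-identityˡ _) (zeroʳ y))
        shift-linear (suc N) = refl
        regroup : ∀ a b e x y → (a + y * b) + x * (b + y * e) ≈ a + (x + y) * b + (x * y) * e
        regroup = solve 5 (λ a b e x y → (a :+ y :* b) :+ x :* (b :+ y :* e) := a :+ (x :+ y) :* b :+ (x :* y) :* e) refl

      -- The symmetry z ↦ β z⁻¹ of z + α + β z⁻¹.
      quadraticPower-palindromic : ∀ n N d → N ℕ.+ d ≡ n → P n N ≈ β ^ℕ d * P n (n ℕ.+ d)
      quadraticPower-palindromic zero    zero    zero    _  = sym (*-identityˡ _)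
      quadraticPower-palindromic (suc n) N       zero    eq =
        trans (reflexive (≡.cong (P (suc n)) (≡.trans (≡.sym (ℕₚ.+-identityʳ N)) (≡.trans eq (≡.sym (ℕₚ.+-identityʳ (suc n)))))))
              (sym (*-identityˡ _))
      quadraticPower-palindromic (suc n) N       (suc d) eq = begin
        P (suc n) N
          ≈⟨ quadraticPower-suc n N ⟩
        shift (shift (P n)) N + α * shift (P n) N + β * P n N
          ≈⟨ +-cong (+-cong (twice N (suc (suc d)) (≡.trans (ℕₚ.+-suc N (suc d)) (≡.cong suc eq))) (*-cong refl (once N (suc d) eq)))
                    (*-cong refl (quadraticPower-palindromic n N d (ℕₚ.suc-injective (≡.trans (≡.sym (ℕₚ.+-suc N d)) eq)))) ⟩
        β ^ℕ suc (suc d) * P n (n ℕ.+ suc (suc d)) + α * (β ^ℕ suc d * P n (n ℕ.+ suc d)) + β * (β ^ℕ d * P n (n ℕ.+ d))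
          ≈⟨ regroup β (β ^ℕ d) α (P n (n ℕ.+ suc (suc d))) (P n (n ℕ.+ suc d)) (P n (n ℕ.+ d)) ⟩
        β ^ℕ suc d * (P n (n ℕ.+ d) + α * P n (n ℕ.+ suc d) + β * P n (n ℕ.+ suc (suc d)))
          ≈⟨ *-cong refl (sym (trans (quadraticPower-suc n (suc (n ℕ.+ suc d))) reindex)) ⟩
        β ^ℕ suc d * P (suc n) (suc n ℕ.+ suc d) ∎
        where
        once : ∀ M e → M ℕ.+ e ≡ suc n → shift (P n) M ≈ β ^ℕ e * P n (n ℕ.+ e)
        once zero    e e≡1+n = sym (trans (*-cong refl (quadraticPower-vanishes n (n ℕ.+ e)
                                 (ℕₚ.+-monoʳ-< n (≡.subst (n <_) (≡.sym e≡1+n) ℕₚ.≤-refl)))) (zeroʳ _))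
        once (suc M) e eq′  = quadraticPower-palindromic n M e (ℕₚ.suc-injective eq′)
        twice : ∀ M e → M ℕ.+ e ≡ suc (suc n) → shift (shift (P n)) M ≈ β ^ℕ e * P n (n ℕ.+ e)
        twice zero    e e≡2+n = sym (trans (*-cong refl (quadraticPower-vanishes n (n ℕ.+ e)
                                  (ℕₚ.+-monoʳ-< n (≡.subst (n <_) (≡.sym e≡2+n) (ℕₚ.m<n⇒m<1+n ℕₚ.≤-refl))))) (zeroʳ _))
        twice (suc M) e eq′  = once M e (ℕₚ.suc-injective eq′)
        reindex : shift (shift (P n)) (suc (n ℕ.+ suc d)) + α * shift (P n) (suc (n ℕ.+ suc d)) + β * P n (suc (n ℕ.+ suc d))
                  ≈ P n (n ℕ.+ d) + α * P n (n ℕ.+ suc d) + β * P n (n ℕ.+ suc (suc d))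
        reindex = +-cong (+-cong (reflexive (≡.cong (shift (P n)) (ℕₚ.+-suc n d))) refl)
                         (*-cong refl (reflexive (≡.cong (P n) (≡.sym (ℕₚ.+-suc n (suc d))))))
        regroup : ∀ β b α A B D → β * (β * b) * A + α * (β * b * B) + β * (b * D) ≈ β * b * (D + α * B + β * A)
        regroup = solve 6 (λ β b α A B D → β :* (β :* b) :* A :+ α :* (β :* b :* B) :+ β :* (b :* D)
                                            := β :* b :* (D :+ α :* B :+ β :* A)) refl

      quadraticPower-belowMiddle : ∀ n → shift (P n) n ≈ β * P n (suc n)
      quadraticPower-belowMiddle zero    = sym (trans (*-cong refl (quadraticPower-initial 1)) (zeroʳ β))
      quadraticPower-belowMiddle (suc n) =
        trans (quadraticPower-palindromic (suc n) n 1 (ℕₚ.+-comm n 1))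
              (*-cong (*-identityʳ β) (reflexive (≡.cong (P (suc n)) (ℕₚ.+-comm (suc n) 1))))

      quadraticPower-isTrinomialArray : IsTrinomialArray α β (λ n h → P n (n ℕ.+ h))
      quadraticPower-isTrinomialArray = record { initial = quadraticPower-initial ; boundary = boundary ; interior = interior }
        where
        interior : ∀ n h → P (suc n) (suc (n ℕ.+ suc h)) ≈ P n (n ℕ.+ h) + α * P n (n ℕ.+ suc h) + β * P n (n ℕ.+ suc (suc h))
        interior n h = trans (quadraticPower-suc n (suc (n ℕ.+ suc h)))
          (+-cong (+-cong (reflexive (≡.cong (shift (P n)) (ℕₚ.+-suc n h))) refl)
                  (*-cong refl (reflexive (≡.cong (P n) (≡.sym (ℕₚ.+-suc n (suc h)))))))
        boundary : ∀ n → P (suc n) (suc (n ℕ.+ 0)) ≈ α * P n (n ℕ.+ 0) + (β + β) * P n (n ℕ.+ 1)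
        boundary n = begin
          P (suc n) (suc (n ℕ.+ 0))
            ≈⟨ quadraticPower-suc n (suc (n ℕ.+ 0)) ⟩
          shift (P n) (n ℕ.+ 0) + α * P n (n ℕ.+ 0) + β * P n (suc (n ℕ.+ 0))
            ≈⟨ +-cong (+-cong (trans (reflexive (≡.cong (shift (P n)) (ℕₚ.+-identityʳ n)))
                                     (trans (quadraticPower-belowMiddle n) (*-cong refl (reflexive (≡.cong (P n) (ℕₚ.+-comm 1 n))))))
                              refl)
                      (*-cong refl (reflexive (≡.cong (P n) (≡.sym (ℕₚ.+-suc n 0))))) ⟩
          β * P n (n ℕ.+ 1) + α * P n (n ℕ.+ 0) + β * P n (n ℕ.+ 1)
            ≈⟨ regroup β α _ _ ⟩
          α * P n (n ℕ.+ 0) + (β + β) * P n (n ℕ.+ 1) ∎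
          where
          regroup : ∀ b a v w → b * w + a * v + b * w ≈ a * v + (b + b) * w
          regroup = solve 4 (λ b a v w → b :* w :+ a :* v :+ b :* w := a :* v :+ (b :+ b) :* w) refl

      catalanTerm : ℕ → ℕ → Carrier
      catalanTerm n j = monomial (catalan j ℕ.* binom (suc n ℕ.+ j) (2 ℕ.* j)) s (suc n ∸ j) y j

      catalanSum : ℕ → Carrier
      catalanSum n = sumTo (suc n) (catalanTerm n)

      private
        raised : ℕ → ℕ → ℕ
        raised n j = binom (suc n) (suc j) ℕ.* binom (n ℕ.+ suc j) (suc (suc n))

      β*mixedTerm-split : ∀ n j → β * r (suc n) n (suc (suc n)) (suc j)
                                  ≈ monomial (raised n j) s (n ∸ j) y (suc j) + monomial (raised n j) s (suc n ∸ j) y j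
      β*mixedTerm-split n zero =
        trans (*-cong refl (monomial≈0 s n y _ raised≡0))
              (trans (zeroʳ β) (sym (trans (+-cong (monomial≈0 s n y 1 raised≡0) (monomial≈0 s (suc n) y 0 raised≡0)) (+-identityʳ 0#))))
        where
        raised≡0 : raised n 0 ≡ 0
        raised≡0 = ≡.trans (≡.cong (binom (suc n) 1 ℕ.*_) (binom≡0 (n ℕ.+ 1) (suc (suc n)) (≡.subst (_< suc (suc n)) (ℕₚ.+-comm 1 n) ℕₚ.≤-refl)))
                           (ℕₚ.*-zeroʳ (binom (suc n) 1))
      β*mixedTerm-split n (suc j) = begin
        β * monomial (raised n (suc j)) s (n ∸ suc j) y ((n ℕ.+ suc (suc j)) ∸ suc (suc n))
          ≡⟨ ≡.cong (λ e → β * monomial (raised n (suc j)) s (n ∸ suc j) y e) exponent ⟩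
        β * M
          ≈⟨ *-cong (trans β≈xy (*-cong x≈y+s refl)) refl ⟩
        (y + s) * y * M
          ≈⟨ trans (*-assoc _ _ _) (distribʳ _ y s) ⟩
        y * (y * M) + s * (y * M)
          ≈⟨ +-cong (trans (*-cong refl (sym (monomial-sucʳ _ s (n ∸ suc j) y j))) (sym (monomial-sucʳ _ s (n ∸ suc j) y (suc j))))
                    (trans (x∙yz≈y∙xz s y M) (*-cong refl (sym (monomial-∸-step _ s n j y j vanish)))) ⟩
        monomial (raised n (suc j)) s (n ∸ suc j) y (suc (suc j)) + y * monomial (raised n (suc j)) s (n ∸ j) y j
          ≈⟨ +-cong refl (sym (monomial-sucʳ _ s (n ∸ j) y j)) ⟩
        monomial (raised n (suc j)) s (n ∸ suc j) y (suc (suc j)) + monomial (raised n (suc j)) s (n ∸ j) y (suc j) ∎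
        where
        M : Carrier
        M = monomial (raised n (suc j)) s (n ∸ suc j) y j
        exponent : (n ℕ.+ suc (suc j)) ∸ suc (suc n) ≡ j
        exponent = ≡.trans (≡.cong (_∸ suc (suc n)) (≡.trans (ℕₚ.+-suc n (suc j)) (≡.cong suc (ℕₚ.+-suc n j)))) (ℕₚ.m+n∸m≡n n j)
        vanish : n ≤ j → raised n (suc j) ≡ 0
        vanish n≤j = ≡.cong (ℕ._* binom (n ℕ.+ suc (suc j)) (suc (suc n))) (binom≡0 (suc n) (suc (suc j)) (s≤s (s≤s n≤j)))

      -- Coefficientwise this is catalan-decomposition.
      catalanSum-decomposition : ∀ n → catalanSum n + β * R (suc n) n (suc (suc n)) ≈ R (suc n) n n
      catalanSum-decomposition n = begin
        catalanSum n + β * R (suc n) n (suc (suc n))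
          ≈⟨ +-cong refl (*-distribˡ-sumTo (suc n) β _) ⟩
        catalanSum n + sumTo (suc n) (λ j → β * r (suc n) n (suc (suc n)) j)
          ≈⟨ +-cong refl (sumTo-shifted-+ n _ (λ j → E (below j) j) (λ j → E (raised n j) j) first (λ j _ → β*mixedTerm-split n j)) ⟩
        catalanSum n + (sumTo (suc n) (λ j → E (below j) j) + sumTo n (λ j → E (raised n j) j))
          ≈⟨ +-cong refl (+-cong refl (sumTo-dropLast n _ (monomial≈0 s (n ∸ n) y (suc n) raised[1+n]≡0))) ⟨
        catalanSum n + (sumTo (suc n) (λ j → E (below j) j) + sumTo (suc n) (λ j → E (raised n j) j))
          ≈⟨ trans (+-cong refl (sym (sumTo-+ (suc n) _ _))) (sym (sumTo-+ (suc n) _ _)) ⟩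
        sumTo (suc n) (λ j → catalanTerm n j + (E (below j) j + E (raised n j) j))
          ≈⟨ sumTo-cong (suc n) (λ j _ → combined j) ⟩
        R (suc n) n n ∎
        where
        E : ℕ → ℕ → Carrier
        E k j = monomial k s (suc n ∸ j) y j
        below : ℕ → ℕ
        below j = binom (suc n) j ℕ.* binom (n ℕ.+ j) (suc (suc n))
        raised[1+n]≡0 : raised n (suc n) ≡ 0
        raised[1+n]≡0 = ≡.cong (ℕ._* binom (n ℕ.+ suc (suc n)) (suc (suc n))) (binom≡0 (suc n) (suc (suc n)) ℕₚ.≤-refl)
        below[0]≡0 : below 0 ≡ 0
        below[0]≡0 = ≡.cong (1 ℕ.*_) (binom≡0 (n ℕ.+ 0) (suc (suc n))
                       (≡.subst (_< suc (suc n)) (≡.sym (ℕₚ.+-identityʳ n)) (ℕₚ.m<n⇒m<1+n ℕₚ.≤-refl)))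
        first : β * r (suc n) n (suc (suc n)) 0 ≈ E (below 0) 0
        first = trans (*-cong refl (monomial≈0 s (suc n) y _ below[0]≡0)) (trans (zeroʳ β) (sym (monomial≈0 s (suc n) y 0 below[0]≡0)))
        combined : ∀ j → catalanTerm n j + (E (below j) j + E (raised n j) j) ≈ r (suc n) n n j
        combined j = begin
          catalanTerm n j + (E (below j) j + E (raised n j) j)
            ≈⟨ trans (+-cong refl (sym (monomial-homo-+ (below j) (raised n j) s (suc n ∸ j) y j))) (sym (monomial-homo-+ _ _ s (suc n ∸ j) y j)) ⟩
          E (catalan j ℕ.* binom (suc n ℕ.+ j) (2 ℕ.* j) ℕ.+ (below j ℕ.+ raised n j)) j
            ≡⟨ ≡.cong (λ k → E k j) (≡.sym (≡.trans (catalan-decomposition n j) (ℕₚ.+-assoc _ (below j) (raised n j)))) ⟩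
          E (binom (suc n) j ℕ.* binom (n ℕ.+ j) n) j
            ≡⟨ ≡.cong (monomial (binom (suc n) j ℕ.* binom (n ℕ.+ j) n) s (suc n ∸ j) y) (≡.sym (ℕₚ.m+n∸m≡n n j)) ⟩
          r (suc n) n n j ∎

      catalanSum≈x*narayanaSum : x * x ⁻¹ ≈ 1# → ∀ n → catalanSum n ≈ x * narayanaSum x β n
      catalanSum≈x*narayanaSum x*x⁻¹≈1 n = +-cancelʳ (β * P n (suc n) + β * (x * P n (suc (suc n)))) _ _ (begin
        catalanSum n + (β * P n (suc n) + β * (x * P n (suc (suc n))))
          ≈⟨ +-cong refl (sym (distribˡ β _ _)) ⟩
        catalanSum n + β * (P n (suc n) + x * P n (suc (suc n)))
          ≈⟨ +-cong refl (*-cong refl (mixedProduct-sucˡ′ x≈y+s n n (suc (suc n)))) ⟨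
        catalanSum n + β * R (suc n) n (suc (suc n))
          ≈⟨ catalanSum-decomposition n ⟩
        R (suc n) n n
          ≈⟨ mixedProduct-sucˡ′ x≈y+s n n n ⟩
        shift (P n) n + x * P n n
          ≈⟨ +-cong (quadraticPower-belowMiddle n) (*-cong refl middle) ⟩
        β * P n (suc n) + x * (narayanaSum x β n + β * P n (suc (suc n)))
          ≈⟨ regroup β (P n (suc n)) x (narayanaSum x β n) (P n (suc (suc n))) ⟩
        x * narayanaSum x β n + (β * P n (suc n) + β * (x * P n (suc (suc n)))) ∎)
        where
        agree : ∀ h → factored x y n h ≈ P n (n ℕ.+ h)
        agree = trinomialArray-unique (factored-isTrinomialArray x y α≈x+y β≈xy) quadraticPower-isTrinomialArray n
        middle : P n n ≈ narayanaSum x β n + β * P n (suc (suc n))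
        middle = begin
          P n n                                          ≡⟨ ≡.cong (P n) (ℕₚ.+-identityʳ n) ⟨
          P n (n ℕ.+ 0)                                  ≈⟨ agree 0 ⟨
          factored x y n 0                               ≈⟨ narayana-reflection x*x⁻¹≈1 β≈xy n ⟨
          narayanaSum x β n + β * factored x y n 2       ≈⟨ +-cong refl (*-cong refl (trans (agree 2) (reflexive (≡.cong (P n) (ℕₚ.+-comm n 2))))) ⟩
          narayanaSum x β n + β * P n (suc (suc n))      ∎
        regroup : ∀ b p x a q → b * p + x * (a + b * q) ≈ x * a + (b * p + b * (x * q))
        regroup = solve 5 (λ b p x a q → b :* p :+ x :* (a :+ b :* q) := x :* a :+ (b :* p :+ b :* (x :* q))) refl

  inverse-unique : ∀ u v → u * v ≈ 1# → u ⁻¹ ≈ v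
  inverse-unique u v uv≈1 = begin
    u ⁻¹                ≈⟨ *-identityʳ _ ⟨
    u ⁻¹ * 1#           ≈⟨ *-cong refl uv≈1 ⟨
    u ⁻¹ * (u * v)      ≈⟨ *-assoc _ _ _ ⟨
    u ⁻¹ * u * v        ≈⟨ *-cong (trans (*-comm _ _) (⁻¹-inverse u u≉0)) refl ⟩
    1# * v              ≈⟨ *-identityˡ v ⟩
    v                   ∎
    where
    u≉0 : ¬ (u ≈ 0#)
    u≉0 u≈0 = char-zero 0 (trans ⟦1⟧≈1 (trans (sym uv≈1) (trans (*-cong u≈0 refl) (zeroˡ v))))

  catalanSeriesTerm : Carrier → Carrier → ℕ → ℕ → Carrier
  catalanSeriesTerm α s n k = (((α ÷ s) - 1#) ^ℕ suc k) * (⟦ catalan k ⟧ ÷ (⟦ 2 ⟧ ^ℕ suc k)) * ⟦ (suc n ℕ.+ k) C (2 ℕ.* k) ⟧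

  module _ {α β s : Carrier} (β≉0 : ¬ (β ≈ 0#)) (α²≉4β : ¬ (α * α ≈ ⟦ 4 ⟧ * β)) (s²≈α²-4β : s * s ≈ α * α - ⟦ 4 ⟧ * β) where

    -- x and y are the roots of t² - α t + β.
    private
      ½ x y : Carrier
      ½ = ⟦ 2 ⟧ ⁻¹
      x = (α + s) ÷ ⟦ 2 ⟧
      y = (α - s) ÷ ⟦ 2 ⟧

      2*½≈1 : ⟦ 2 ⟧ * ½ ≈ 1#
      2*½≈1 = ⁻¹-inverse ⟦ 2 ⟧ (char-zero 1)

      halve : ∀ a → (a + a) * ½ ≈ a
      halve a = begin
        (a + a) * ½                 ≈⟨ *-cong (+-cong (*-identityˡ a) (*-identityˡ a)) refl ⟨
        (1# * a + 1# * a) * ½       ≈⟨ *-cong (distribʳ a 1# 1#) refl ⟨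
        (1# + 1#) * a * ½           ≈⟨ *-cong (*-cong (+-cong refl (+-identityʳ 1#)) refl) refl ⟨
        ⟦ 2 ⟧ * a * ½               ≈⟨ xy∙z≈y∙xz ⟦ 2 ⟧ a ½ ⟩
        a * (⟦ 2 ⟧ * ½)             ≈⟨ *-cong refl 2*½≈1 ⟩
        a * 1#                      ≈⟨ *-identityʳ a ⟩
        a                           ∎

      α≈x+y : α ≈ x + y
      α≈x+y = sym (begin
        (α + s) * ½ + (α - s) * ½   ≈⟨ distribʳ ½ _ _ ⟨
        (α + s + (α - s)) * ½       ≈⟨ *-cong (+-interchange α s α (- s)) refl ⟩
        (α + α + (s - s)) * ½       ≈⟨ *-cong (trans (+-cong refl (-‿inverseʳ s)) (+-identityʳ _)) refl ⟩
        (α + α) * ½                 ≈⟨ halve α ⟩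
        α                           ∎)

      x≈y+s : x ≈ y + s
      x≈y+s = sym (begin
        (α - s) * ½ + s                   ≈⟨ +-cong refl (halve s) ⟨
        (α - s) * ½ + (s + s) * ½         ≈⟨ distribʳ ½ _ _ ⟨
        (α + - s + (s + s)) * ½           ≈⟨ *-cong (regroup α s (- s)) refl ⟩
        (α + s + (s + - s)) * ½           ≈⟨ *-cong (trans (+-cong refl (-‿inverseʳ s)) (+-identityʳ _)) refl ⟩
        (α + s) * ½                       ∎)
        where
        regroup : ∀ a s n → (a + n) + (s + s) ≈ (a + s) + (s + n)
        regroup = solve 3 (λ a s n → (a :+ n) :+ (s :+ s) := (a :+ s) :+ (s :+ n)) refl

      β≈xy : β ≈ x * y
      β≈xy = sym (begin
        (α + s) * ½ * ((α - s) * ½)             ≈⟨ *-interchange (α + s) ½ (α - s) ½ ⟩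
        (α + s) * (α - s) * (½ * ½)             ≈⟨ *-cong difference-of-squares refl ⟩
        ⟦ 2 ⟧ * ⟦ 2 ⟧ * β * (½ * ½)             ≈⟨ regroup ⟦ 2 ⟧ β ½ ⟩
        β * ((⟦ 2 ⟧ * ½) * (⟦ 2 ⟧ * ½))         ≈⟨ *-cong refl (trans (*-cong 2*½≈1 2*½≈1) (*-identityˡ 1#)) ⟩
        β * 1#                                  ≈⟨ *-identityʳ β ⟩
        β                                       ∎)
        where
        regroup : ∀ t b i → t * t * b * (i * i) ≈ b * ((t * i) * (t * i))
        regroup = solve 3 (λ t b i → t :* t :* b :* (i :* i) := b :* ((t :* i) :* (t :* i))) refl
        expand : ∀ a s n → (a + s) * (a + n) ≈ a * a + s * n + a * (s + n)
        expand = solve 3 (λ a s n → (a :+ s) :* (a :+ n) := a :* a :+ s :* n :+ a :* (s :+ n)) refl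
        difference-of-squares : (α + s) * (α - s) ≈ ⟦ 2 ⟧ * ⟦ 2 ⟧ * β
        difference-of-squares = begin
          (α + s) * (α - s)                       ≈⟨ expand α s (- s) ⟩
          α * α + s * - s + α * (s - s)           ≈⟨ +-cong refl (trans (*-cong refl (-‿inverseʳ s)) (zeroʳ α)) ⟩
          α * α + s * - s + 0#                    ≈⟨ +-identityʳ _ ⟩
          α * α + s * - s                         ≈⟨ +-cong refl (trans (sym (-‿distribʳ-* s s)) (-‿cong s²≈α²-4β)) ⟩
          α * α - (α * α - ⟦ 4 ⟧ * β)             ≈⟨ +-cong refl (⁻¹-anti-homo‿- (α * α) (⟦ 4 ⟧ * β)) ⟩
          α * α + (⟦ 4 ⟧ * β - α * α)             ≈⟨ +-cong refl (+-comm _ _) ⟩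
          α * α + (- (α * α) + ⟦ 4 ⟧ * β)         ≈⟨ +-assoc _ _ _ ⟨
          α * α - α * α + ⟦ 4 ⟧ * β               ≈⟨ trans (+-cong (-‿inverseʳ _) refl) (+-identityˡ _) ⟩
          ⟦ 4 ⟧ * β                               ≈⟨ *-cong (⟦⟧-homo-* 2 2) refl ⟩
          ⟦ 2 ⟧ * ⟦ 2 ⟧ * β                       ∎

      x*x⁻¹≈1 : x * x ⁻¹ ≈ 1#
      x*x⁻¹≈1 = ⁻¹-inverse x (λ x≈0 → β≉0 (trans β≈xy (trans (*-cong x≈0 refl) (zeroˡ y))))

      s*s⁻¹≈1 : s * s ⁻¹ ≈ 1#
      s*s⁻¹≈1 = ⁻¹-inverse s (λ s≈0 → α²≉4β (x∙y⁻¹≈ε⇒x≈y _ _ (trans (sym s²≈α²-4β) (trans (*-cong s≈0 refl) (zeroˡ s)))))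

      w½≈ys⁻¹ : ((α ÷ s) - 1#) * ½ ≈ y * s ⁻¹
      w½≈ys⁻¹ = sym (begin
        (α + - s) * ½ * s ⁻¹                ≈⟨ xy∙z≈xz∙y _ _ _ ⟩
        (α + - s) * s ⁻¹ * ½                ≈⟨ *-cong (distribʳ _ α (- s)) refl ⟩
        (α * s ⁻¹ + - s * s ⁻¹) * ½         ≈⟨ *-cong (+-cong refl (trans (sym (-‿distribˡ-* s _)) (-‿cong s*s⁻¹≈1))) refl ⟩
        (α * s ⁻¹ + - 1#) * ½               ∎)

      2^k⁻¹≈½^k : ∀ k → (⟦ 2 ⟧ ^ℕ k) ⁻¹ ≈ ½ ^ℕ k
      2^k⁻¹≈½^k k = inverse-unique _ _ (trans (*-comm _ _) (^ℕ-inverse 2*½≈1 k))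

      catalanTerm′ : ℕ → ℕ → Carrier
      catalanTerm′ = catalanTerm s y x≈y+s α≈x+y β≈xy

    s^[n+2]*catalanSeriesTerm : ∀ n k → k ≤ suc n → s ^ℕ (n ℕ.+ 2) * catalanSeriesTerm α s n k ≈ y * catalanTerm′ n k
    s^[n+2]*catalanSeriesTerm n k k≤1+n = begin
      s ^ℕ (n ℕ.+ 2) * (w ^ℕ suc k * (⟦ catalan k ⟧ * (⟦ 2 ⟧ ^ℕ suc k) ⁻¹) * ⟦ (suc n ℕ.+ k) C (2 ℕ.* k) ⟧)
        ≈⟨ *-cong (reflexive (≡.cong (s ^ℕ_) (ℕₚ.+-comm n 2)))
                  (*-cong (*-cong refl (*-cong refl (2^k⁻¹≈½^k (suc k)))) (reflexive (≡.cong ⟦_⟧ (≡.sym (binom≡C (suc n ℕ.+ k) (2 ℕ.* k)))))) ⟩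
      s ^ℕ suc (suc n) * (w ^ℕ suc k * (⟦ catalan k ⟧ * ½ ^ℕ suc k) * ⟦ b ⟧)
        ≈⟨ *-cong refl (regroup₁ (w ^ℕ suc k) ⟦ catalan k ⟧ (½ ^ℕ suc k) ⟦ b ⟧) ⟩
      s ^ℕ suc (suc n) * (w ^ℕ suc k * ½ ^ℕ suc k * (⟦ catalan k ⟧ * ⟦ b ⟧))
        ≈⟨ *-cong refl (*-cong (trans (sym (^ℕ-distrib-* w ½ (suc k))) (trans (^ℕ-congˡ (suc k) w½≈ys⁻¹) (^ℕ-distrib-* y (s ⁻¹) (suc k))))
                               (sym (⟦⟧-homo-* (catalan k) b))) ⟩
      s ^ℕ suc (suc n) * (y ^ℕ suc k * (s ⁻¹) ^ℕ suc k * ⟦ catalan k ℕ.* b ⟧)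
        ≈⟨ regroup₂ (s ^ℕ suc (suc n)) (y ^ℕ suc k) ((s ⁻¹) ^ℕ suc k) ⟦ catalan k ℕ.* b ⟧ ⟩
      s ^ℕ suc (suc n) * (s ⁻¹) ^ℕ suc k * (y ^ℕ suc k * ⟦ catalan k ℕ.* b ⟧)
        ≈⟨ *-cong (^ℕ-cancel s*s⁻¹≈1 (s≤s k≤1+n)) refl ⟩
      s ^ℕ (suc n ∸ k) * (y * y ^ℕ k * ⟦ catalan k ℕ.* b ⟧)
        ≈⟨ regroup₃ (s ^ℕ (suc n ∸ k)) y (y ^ℕ k) ⟦ catalan k ℕ.* b ⟧ ⟩
      y * (⟦ catalan k ℕ.* b ⟧ * s ^ℕ (suc n ∸ k) * y ^ℕ k)
        ≡⟨ ≡.cong (y *_) (≡.sym (monomial≡ (catalan k ℕ.* b) s (suc n ∸ k) y k)) ⟩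
      y * catalanTerm′ n k ∎
      where
      w : Carrier
      w = (α ÷ s) - 1#
      b : ℕ
      b = binom (suc n ℕ.+ k) (2 ℕ.* k)
      regroup₁ : ∀ p c h d → p * (c * h) * d ≈ p * h * (c * d)
      regroup₁ = solve 4 (λ p c h d → p :* (c :* h) :* d := p :* h :* (c :* d)) refl
      regroup₂ : ∀ a b e d → a * (b * e * d) ≈ a * e * (b * d)
      regroup₂ = solve 4 (λ a b e d → a :* (b :* e :* d) := a :* e :* (b :* d)) refl
      regroup₃ : ∀ a y z d → a * (y * z * d) ≈ y * (d * a * z)
      regroup₃ = solve 4 (λ a y z d → a :* (y :* z :* d) := y :* (d :* a :* z)) refl

    motzkin≈narayanaSum-root : ∀ n → motzkin F n α β ≈ narayanaSum x β n
    motzkin≈narayanaSum-root = motzkin≈narayanaSum x*x⁻¹≈1 β≈xy α≈x+y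

    narayanaSum≈catalanSeries : ∀ n → narayanaSum x β n ≈ ((s ^ℕ (n ℕ.+ 2)) ÷ β) * sumTo (suc n) (catalanSeriesTerm α s n)
    narayanaSum≈catalanSeries n = sym (begin
      s ^ℕ (n ℕ.+ 2) * β ⁻¹ * sumTo (suc n) (catalanSeriesTerm α s n)
        ≈⟨ trans (xy∙z≈y∙xz _ _ _) (*-cong refl (*-distribˡ-sumTo (suc n) _ _)) ⟩
      β ⁻¹ * sumTo (suc n) (λ k → s ^ℕ (n ℕ.+ 2) * catalanSeriesTerm α s n k)
        ≈⟨ *-cong refl (sumTo-cong (suc n) (s^[n+2]*catalanSeriesTerm n)) ⟩
      β ⁻¹ * sumTo (suc n) (λ k → y * catalanTerm′ n k)
        ≈⟨ *-cong refl (*-distribˡ-sumTo (suc n) y _) ⟨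
      β ⁻¹ * (y * catalanSum s y x≈y+s α≈x+y β≈xy n)
        ≈⟨ *-cong refl (*-cong refl (catalanSum≈x*narayanaSum s y x≈y+s α≈x+y β≈xy x*x⁻¹≈1 n)) ⟩
      β ⁻¹ * (y * (x * narayanaSum x β n))
        ≈⟨ *-cong refl (trans (x∙yz≈xy∙z y x _) (*-cong (trans (*-comm y x) (sym β≈xy)) refl)) ⟩
      β ⁻¹ * (β * narayanaSum x β n)
        ≈⟨ trans (sym (*-assoc _ _ _)) (*-cong (trans (*-comm _ _) (⁻¹-inverse β β≉0)) refl) ⟩
      1# * narayanaSum x β n
        ≈⟨ *-identityˡ _ ⟩
      narayanaSum x β n ∎)

open CoefficientArrays using (motzkin≈narayanaSum-root; narayanaSum≈catalanSeries)

proposition3p2 : ∀ {c ℓ : Level} (F : CharZeroField c ℓ) → let open CharZeroField F in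
    ∀ (α β s : Carrier) (n : ℕ) →
    ¬ (β ≈ 0#) →
    ¬ (α * α ≈ ⟦ 4 ⟧ * β) →
    s * s ≈ α * α - ⟦ 4 ⟧ * β →
    (motzkin F n α β
       ≈ sumTo (suc n) (λ k →
           (((α + s) ÷ ⟦ 2 ⟧) ^ℤ ((+ n) ℤ.- (+ (2 ℕ.* k))))
           * ((β ^ℕ k) ÷ ⟦ suc n ⟧)
           * ⟦ (suc n C k) ℕ.* (suc n C suc k) ⟧))
    × (sumTo (suc n) (λ k →
           (((α + s) ÷ ⟦ 2 ⟧) ^ℤ ((+ n) ℤ.- (+ (2 ℕ.* k))))
           * ((β ^ℕ k) ÷ ⟦ suc n ⟧)
           * ⟦ (suc n C k) ℕ.* (suc n C suc k) ⟧)
       ≈ ((s ^ℕ (n ℕ.+ 2)) ÷ β)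
         * sumTo (suc n) (λ k →
             (((α ÷ s) - 1#) ^ℕ suc k)
             * (⟦ catalan k ⟧ ÷ (⟦ 2 ⟧ ^ℕ suc k))
             * ⟦ (suc n ℕ.+ k) C (2 ℕ.* k) ⟧))
proposition3p2 F α β s n β≉0 α²≉4β s²≈α²-4β =
  motzkin≈narayanaSum-root F β≉0 α²≉4β s²≈α²-4β n , narayanaSum≈catalanSeries F β≉0 α²≉4β s²≈α²-4β n
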